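{- For $n\ge 1$ let $S_n(132)$ be the set of permutations of $\{1,\dots,n\}$ avoiding the pattern $132$. For $\sigma=\sigma_1\cdots\sigma_n$, let $\mathrm{box}(\sigma)$ be the number of indices $i\in\{1,\dots,n\}$ such that $|\sigma_i-\sigma_{i+1}|=1$ or $|\sigma_{i-1}-\sigma_i|=1$ (conditions involving nonexistent entries $\sigma_0,\sigma_{n+1}$ are ignored). Set $A_0(x)=1$ and, for $n\ge1$, $$A_n(x)=\sum_{\sigma\in S_n(132)}x^{\mathrm{box}(\sigma)},\quad B_n(x)=\sum_{\sigma\in S_n(132),\,\sigma_1=n}x^{\mathrm{box}(\sigma)},\quad E_n(x)=\sum_{\sigma\in S_n(132),\,\sigma_n=n}x^{\mathrm{box}(\sigma)}.$$ Then $B_n(x)=E_n(x)$ for all $n\ge1$; for $n\ge4$, $$B_n(x)=x^n+\big(A_{n-1}(x)-B_{n-1}(x)\big)+\sum_{i=2}^{n-2}x^{n-i}\big(A_i(x)-B_i(x)\big);$$ and for $n\ge2$, $$A_n(x)=B_n(x)+\sum_{i=2}^{n}B_i(x)A_{n-i}(x).$$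
   Context: A permutation $\sigma\in S_n$ avoids $132$ if there are no indices $i<j<k$ with $\sigma_i<\sigma_k<\sigma_j$. An index $i$ counted in $\mathrm{box}(\sigma)$ is called an occurrence of the 1-box pattern in $\sigma$. -}

module Defs where

open import Data.Nat as ℕ using (ℕ; zero; suc; _≤ᵇ_; _<ᵇ_; _≡ᵇ_; ∣_-_∣; _∸_)
open import Data.Bool using (Bool; true; false; _∧_; _∨_; if_then_else_)
open import Data.List using (List; []; _∷_; map; concatMap; filter; length; upTo; foldr)
open import Data.Integer as ℤ using (ℤ)
open import Relation.Binary.PropositionalEquality using (_≡_)
open import Relation.Nullary.Decidable using (Dec)
open import Data.Bool.Properties using (T?)

-- Permutations of {1,…,n}, written as the word σ₁σ₂…σₙ (a List ℕ).

insertions : ℕ → List ℕ → List (List ℕ)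
insertions x []       = (x ∷ []) ∷ []
insertions x (y ∷ ys) = (x ∷ y ∷ ys) ∷ map (y ∷_) (insertions x ys)

perms : ℕ → List (List ℕ)
perms zero    = [] ∷ []
perms (suc n) = concatMap (insertions (suc n)) (perms n)

-- is there j<k in the word with a < w_k < w_j ?
has32above : ℕ → List ℕ → Bool
has32above a []       = false
has32above a (b ∷ ws) =
  ((a <ᵇ b) ∧ foldr (λ c r → ((a <ᵇ c) ∧ (c <ᵇ b)) ∨ r) false ws)
  ∨ has32above a ws

contains132 : List ℕ → Bool
contains132 []       = false
contains132 (a ∷ ws) = has32above a ws ∨ contains132 ws

avoids132 : List ℕ → Bool
avoids132 σ = if contains132 σ then false else true

S132 : ℕ → List (List ℕ)
S132 n = filter (λ σ → T? (avoids132 σ)) (perms n)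

-- box statistic (positions are 0-based here: σ at i = σ_{i+1})

_at_ : List ℕ → ℕ → ℕ
[]       at i     = 0
(x ∷ xs) at zero  = x
(x ∷ xs) at suc i = xs at i

adj : ℕ → ℕ → Bool
adj a b = ∣ a - b ∣ ≡ᵇ 1

boxed : List ℕ → ℕ → Bool
boxed σ i = ((suc i <ᵇ length σ) ∧ adj (σ at i) (σ at suc i))
          ∨ ((1 ≤ᵇ i) ∧ adj (σ at (i ∸ 1)) (σ at i))

box : List ℕ → ℕ
box σ = length (filter (λ i → T? (boxed σ i)) (upTo (length σ)))

-- Polynomials in x with integer coefficients, as coefficient sequences:
-- P k = coefficient of x^k.

Poly : Set
Poly = ℕ → ℤ

_≈_ : Poly → Poly → Set
P ≈ Q = ∀ k → P k ≡ Q k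

infix 4 _≈_
infixl 6 _⊕_ _⊖_
infixl 7 _⊛_

_⊕_ : Poly → Poly → Poly
(P ⊕ Q) k = P k ℤ.+ Q k

_⊖_ : Poly → Poly → Poly
(P ⊖ Q) k = P k ℤ.- Q k

_⊛_ : Poly → Poly → Poly
(P ⊛ Q) k = foldr (λ j r → P j ℤ.* Q (k ∸ j) ℤ.+ r) (ℤ.+ 0) (upTo (suc k))

X^ : ℕ → Poly
X^ m k = if k ≡ᵇ m then ℤ.+ 1 else ℤ.+ 0

Σ[_]_ : List ℕ → (ℕ → Poly) → Poly
Σ[ is ] F = foldr (λ i R → F i ⊕ R) (λ _ → ℤ.+ 0) is

-- the indices a, a+1, …, b  (empty if b < a)
range : ℕ → ℕ → List ℕ
range a b = map (a ℕ.+_) (upTo (suc b ∸ a))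

gf : List (List ℕ) → Poly
gf L k = ℤ.+ length (filter (λ σ → box σ ℕ.≟ k) L)

A : ℕ → Poly
A zero    = X^ 0
A (suc n) = gf (S132 (suc n))

B : ℕ → Poly
B n = gf (filter (λ σ → (σ at 0) ℕ.≟ n) (S132 n))

E : ℕ → Poly
E n = gf (filter (λ σ → (σ at (n ∸ 1)) ℕ.≟ n) (S132 n))

-- A word σ ∈ S_n(132) factors uniquely as α′ n β, where β ∈ S_{n-i}(132) and α′ is some
-- α ∈ S_{i-1}(132) raised by n - i.  Since n is not adjacent to the first entry of β,
-- box σ = box (α i) + box β, and as α i runs over the words counted by
-- E_i = B_i, summing over the position i of n gives the recurrence for A_n.
--
-- For B_n, delete the leading n: the words n β with β₁ ≠ n - 1 have box (n β) = box β and contribute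
-- A_{n-1} - B_{n-1}; the words n (n-1) γ satisfy box = 2 + box γ if γ₁ ≠ n - 2 and otherwise lose one
-- box when the leading n is deleted, and unrolling this along the run gives the closed formula.  The
-- mirror argument for words ending in n gives the same recurrences for E_n in terms of A - E, so
-- B_n = E_n by induction on n.

module Submission where

open import Defs
open import Data.Nat
  using (ℕ; zero; suc; _+_; _∸_; _≤_; _<_; z≤n; s≤s; _≟_; _<ᵇ_; _≡ᵇ_)
import Data.Nat.Properties as ℕₚ
open import Data.Integer as ℤ using (ℤ)
import Data.Integer.Properties as ℤₚ
open import Data.Integer.Solver using (module +-*-Solver)
open import Data.Bool using (Bool; true; false; _∧_; _∨_; T)
open import Data.Bool.Properties using (T?; T-∨; T-∧)
open import Data.Unit using (tt)
open import Data.Maybe using (Maybe; just; nothing)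
open import Data.List
  using (List; []; _∷_; [_]; _++_; map; concatMap; filter; length; upTo; applyUpTo; foldr; take)
open import Data.List.Properties
  using (∷-injectiveˡ; ∷-injectiveʳ; ++-assoc; ++-identityʳ; ++-cancelˡ; ++-cancelʳ;
         length-++; length-++-sucʳ; length-map; map-++; filter-accept; filter-reject; filter-all; filter-++;
         map-upTo; upTo-∷ʳ; foldr-map; map-∘; map-cong; map-id; map-id-local)
open import Data.List.Membership.Propositional using (_∈_; find; lose)
open import Data.List.Membership.Propositional.Properties
  using (∈-map⁺; ∈-map⁻; ∈-concatMap⁺; ∈-concatMap⁻; ∈-∃++; ∈-++⁻; ∈-++⁺ˡ; ∈-++⁺ʳ;
         ∈-filter⁺; ∈-filter⁻; ∈-upTo⁺; ∈-upTo⁻)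
open import Data.List.Membership.Propositional.Properties.WithK using (unique∧set⇒bag)
open import Data.List.Relation.Binary.BagAndSetEquality using (∼bag⇒↭)
open import Data.List.Relation.Unary.Any as Any using (Any; here; there)
import Data.List.Relation.Unary.Any.Properties as Anyₚ
open import Data.List.Relation.Unary.All as All using (All; []; _∷_)
open import Data.List.Relation.Unary.AllPairs using ([]; _∷_)
open import Data.List.Relation.Unary.Unique.Propositional using (Unique)
import Data.List.Relation.Unary.Unique.Propositional.Properties as Uniqueₚ
open import Data.List.Relation.Binary.Permutation.Propositional
  using (_↭_; ↭-refl; ↭-sym; ↭-trans; ↭-prep; ↭-swap; ↭⇒↭ₛ)
open import Data.List.Relation.Binary.Permutation.Propositional.Properties
  using (∈-resp-↭; ↭-empty-inv; drop-mid; drop-∷; ↭-length; filter-↭; ++⁺)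
  renaming (map⁺ to ↭-map⁺; shift to ↭-shift)
import Data.List.Relation.Binary.Permutation.Setoid.Properties as ↭ₛ
open import Data.Product using (∃; _×_; _,_; proj₁; proj₂)
open import Data.Sum using (inj₁; inj₂)
open import Data.Empty using (⊥-elim)
open import Function using (_∘_; _⇔_; mk⇔; Equivalence)
open import Relation.Nullary using (¬_; yes; no; ¬?)
open import Relation.Unary using (Pred; Decidable)
open import Relation.Binary.Bundles using (Setoid)
import Relation.Binary.Reasoning.Setoid as SetoidReasoning
open import Relation.Binary.PropositionalEquality
  using (_≡_; _≢_; refl; sym; trans; cong; cong₂; subst; setoid; module ≡-Reasoning)

-- Lists without repetitions

Unique-map-injectiveOn : ∀ {A B : Set} (f : A → B) {xs} → Unique xs →
                         (∀ {x y} → x ∈ xs → y ∈ xs → f x ≡ f y → x ≡ y) → Unique (map f xs)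
Unique-map-injectiveOn f {[]} [] inj = []
Unique-map-injectiveOn f {x ∷ xs} (x∉xs ∷ u) inj =
  All.tabulate (λ fy∈ fx≡fy → let (y , y∈ , fy≡) = ∈-map⁻ f fy∈ in
                  All.lookup x∉xs y∈ (inj (here refl) (there y∈) (trans fx≡fy fy≡)))
  ∷ Unique-map-injectiveOn f u (λ x∈ y∈ → inj (there x∈) (there y∈))

-- The blocks f x are disjoint because x can be read back from any of their elements.
Unique-concatMap : ∀ {A B : Set} (f : A → List B) (key : B → A) {xs} → Unique xs →
                   (∀ x → x ∈ xs → Unique (f x)) →
                   (∀ x y → x ∈ xs → y ∈ f x → key y ≡ x) →
                   Unique (concatMap f xs)
Unique-concatMap f key {[]} [] uf k = []
Unique-concatMap f key {x ∷ xs} (x∉xs ∷ u) uf k =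
  Uniqueₚ.++⁺ (uf x (here refl))
              (Unique-concatMap f key u (λ z z∈ → uf z (there z∈)) (λ z y z∈ → k z y (there z∈)))
              disjoint
  where
  disjoint : ∀ {y} → ¬ (y ∈ f x × y ∈ concatMap f xs)
  disjoint (y∈fx , y∈rest) with find (∈-concatMap⁻ f {xs} y∈rest)
  ... | x′ , x′∈ , y∈fx′ =
    All.lookup x∉xs x′∈ (trans (sym (k x _ (here refl) y∈fx)) (k x′ _ (there x′∈) y∈fx′))

Unique-resp-↭ : ∀ {xs ys : List ℕ} → xs ↭ ys → Unique xs → Unique ys
Unique-resp-↭ p = ↭ₛ.Unique-resp-↭ (setoid ℕ) (↭⇒↭ₛ p)

Unique-++⇒≢ : ∀ {xs zs : List ℕ} {a b} → Unique (xs ++ zs) → a ∈ xs → b ∈ zs → a ≢ b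
Unique-++⇒≢ {x ∷ xs} (x∉ ∷ u) (here refl) b∈ = All.lookup x∉ (∈-++⁺ʳ xs b∈)
Unique-++⇒≢ {x ∷ xs} (_ ∷ u) (there a∈) b∈ = Unique-++⇒≢ u a∈ b∈

unique-set⇒↭ : ∀ {A : Set} {xs ys : List A} → Unique xs → Unique ys →
               (∀ {z} → z ∈ xs → z ∈ ys) → (∀ {z} → z ∈ ys → z ∈ xs) → xs ↭ ys
unique-set⇒↭ u u′ f g = ∼bag⇒↭ (unique∧set⇒bag u u′ (mk⇔ f g))

-- Permutations

-- interval a k = a+k, …, a+1, decreasing so that interval 0 (suc n) = suc n ∷ interval 0 n.
interval : ℕ → ℕ → List ℕ
interval a zero    = []
interval a (suc k) = a + suc k ∷ interval a k

IsPerm : ℕ → List ℕ → Set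
IsPerm n σ = σ ↭ interval 0 n

∈-interval⁻ : ∀ a k {x} → x ∈ interval a k → a < x × x ≤ a + k
∈-interval⁻ a (suc k) (here refl) = ℕₚ.m<m+n a (s≤s z≤n) , ℕₚ.≤-refl
∈-interval⁻ a (suc k) (there x∈) with ∈-interval⁻ a k x∈
... | a<x , x≤a+k = a<x , ℕₚ.≤-trans x≤a+k (ℕₚ.+-monoʳ-≤ a (ℕₚ.n≤1+n k))

length-interval : ∀ a k → length (interval a k) ≡ k
length-interval a zero    = refl
length-interval a (suc k) = cong suc (length-interval a k)

interval-unique : ∀ a k → Unique (interval a k)
interval-unique a zero    = []
interval-unique a (suc k) =
  All.tabulate (λ x∈ eq → ℕₚ.<-irrefl (sym eq)
                 (ℕₚ.≤-<-trans (proj₂ (∈-interval⁻ a k x∈)) (ℕₚ.+-monoʳ-< a ℕₚ.≤-refl)))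
  ∷ interval-unique a k

map-+-interval : ∀ j k → map (j +_) (interval 0 k) ≡ interval j k
map-+-interval j zero    = refl
map-+-interval j (suc k) = cong (j + suc k ∷_) (map-+-interval j k)

map-∸-interval : ∀ j k → map (_∸ j) (interval j k) ≡ interval 0 k
map-∸-interval j zero    = refl
map-∸-interval j (suc k) = cong₂ _∷_ (ℕₚ.m+n∸m≡n j (suc k)) (map-∸-interval j k)

interval-++ : ∀ j k → interval j k ++ interval 0 j ≡ interval 0 (k + j)
interval-++ j zero    = refl
interval-++ j (suc k) = cong₂ _∷_ (trans (ℕₚ.+-suc j k) (cong suc (ℕₚ.+-comm j k))) (interval-++ j k)

IsPerm⇒≤ : ∀ {n σ x} → IsPerm n σ → x ∈ σ → x ≤ n
IsPerm⇒≤ {n} p x∈ = proj₂ (∈-interval⁻ 0 n (∈-resp-↭ p x∈))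

IsPerm⇒positive : ∀ {n σ x} → IsPerm n σ → x ∈ σ → 1 ≤ x
IsPerm⇒positive {n} p x∈ = proj₁ (∈-interval⁻ 0 n (∈-resp-↭ p x∈))

IsPerm⇒All< : ∀ {n σ} → IsPerm n σ → All (_< suc n) σ
IsPerm⇒All< p = All.tabulate (λ x∈ → s≤s (IsPerm⇒≤ p x∈))

IsPerm⇒length : ∀ {n σ} → IsPerm n σ → length σ ≡ n
IsPerm⇒length {n} p = trans (↭-length p) (length-interval 0 n)

IsPerm⇒Unique : ∀ {n σ} → IsPerm n σ → Unique σ
IsPerm⇒Unique {n} p = Unique-resp-↭ (↭-sym p) (interval-unique 0 n)

insertions-↭ : ∀ x ys {σ} → σ ∈ insertions x ys → σ ↭ x ∷ ys
insertions-↭ x []       (here refl) = ↭-refl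
insertions-↭ x (y ∷ ys) (here refl) = ↭-refl
insertions-↭ x (y ∷ ys) (there σ∈) with ∈-map⁻ (y ∷_) σ∈
... | τ , τ∈ , refl = ↭-trans (↭-prep y (insertions-↭ x ys τ∈)) (↭-swap y x ↭-refl)

∈-insertions : ∀ x as bs → as ++ x ∷ bs ∈ insertions x (as ++ bs)
∈-insertions x []       []       = here refl
∈-insertions x []       (b ∷ bs) = here refl
∈-insertions x (a ∷ as) bs       = there (∈-map⁺ (a ∷_) (∈-insertions x as bs))

erase : ℕ → List ℕ → List ℕ
erase x = filter (λ y → ¬? (x ≟ y))

erase-head : ∀ x {ys} → All (x ≢_) ys → erase x (x ∷ ys) ≡ ys
erase-head x {ys} x∉ys =
  trans (filter-reject (λ y → ¬? (x ≟ y)) {xs = ys} (λ x≢x → x≢x refl))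
        (filter-all (λ y → ¬? (x ≟ y)) x∉ys)

erase-insertions : ∀ x ys {σ} → All (x ≢_) ys → σ ∈ insertions x ys → erase x σ ≡ ys
erase-insertions x []       x∉ys        (here refl) = erase-head x x∉ys
erase-insertions x (y ∷ ys) x∉ys        (here refl) = erase-head x x∉ys
erase-insertions x (y ∷ ys) (x≢y ∷ x∉ys) (there σ∈) with ∈-map⁻ (y ∷_) σ∈
... | τ , τ∈ , refl =
  trans (filter-accept (λ y → ¬? (x ≟ y)) x≢y) (cong (y ∷_) (erase-insertions x ys x∉ys τ∈))

insertions-unique : ∀ x ys → All (x ≢_) ys → Unique (insertions x ys)
insertions-unique x []       _ = [] ∷ []
insertions-unique x (y ∷ ys) (x≢y ∷ x∉ys) =
  All.tabulate (λ σ∈ eq → let (_ , _ , eq′) = ∈-map⁻ (y ∷_) σ∈ in x≢y (∷-injectiveˡ (trans eq eq′)))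
  ∷ Uniqueₚ.map⁺ ∷-injectiveʳ (insertions-unique x ys x∉ys)

perms-sound : ∀ n {σ} → σ ∈ perms n → IsPerm n σ
perms-sound zero    (here refl) = ↭-refl
perms-sound (suc n) σ∈ with find (∈-concatMap⁻ (insertions (suc n)) {perms n} σ∈)
... | τ , τ∈ , σ∈′ = ↭-trans (insertions-↭ (suc n) τ σ∈′) (↭-prep (suc n) (perms-sound n τ∈))

perms-complete : ∀ n {σ} → IsPerm n σ → σ ∈ perms n
perms-complete zero p rewrite ↭-empty-inv p = here refl
perms-complete (suc n) p with ∈-∃++ (∈-resp-↭ (↭-sym p) (here refl))
... | as , bs , refl =
  ∈-concatMap⁺ (insertions (suc n)) (lose (perms-complete n (drop-mid as [] p)) (∈-insertions (suc n) as bs))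

perms-unique : ∀ n → Unique (perms n)
perms-unique zero    = [] ∷ []
perms-unique (suc n) =
  Unique-concatMap (insertions (suc n)) (erase (suc n)) (perms-unique n)
    (λ τ τ∈ → insertions-unique (suc n) τ (fresh τ∈))
    (λ τ σ τ∈ σ∈ → erase-insertions (suc n) τ (fresh τ∈) σ∈)
  where
  fresh : ∀ {τ} → τ ∈ perms n → All (suc n ≢_) τ
  fresh τ∈ = All.tabulate (λ x∈ eq → ℕₚ.<-irrefl (sym eq) (s≤s (IsPerm⇒≤ (perms-sound n τ∈) x∈)))

↭-split-above : ∀ n xs ys → IsPerm n (xs ++ ys) → (∀ {a b} → a ∈ xs → b ∈ ys → b < a) →
                IsPerm (length ys) ys × xs ↭ interval (length ys) (length xs)
↭-split-above zero [] [] p above = ↭-refl , ↭-refl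
↭-split-above zero [] (y ∷ ys) p above with () ← ↭-empty-inv p
↭-split-above zero (x ∷ xs) ys p above with () ← ↭-empty-inv p
↭-split-above (suc n) xs ys p above with ∈-++⁻ xs (∈-resp-↭ (↭-sym p) (here refl))
... | inj₂ n+1∈ys with xs
...   | []     = subst (λ k → IsPerm k ys) (sym (IsPerm⇒length p)) p , ↭-refl
...   | x ∷ _  = ⊥-elim (ℕₚ.<⇒≱ (above (here refl) n+1∈ys) (IsPerm⇒≤ p (here refl)))
↭-split-above (suc n) xs ys p above | inj₁ n+1∈xs with ∈-∃++ n+1∈xs
... | us , vs , refl = ys-perm , xs-perm
  where
  N = suc n
  rest-perm : IsPerm n ((us ++ vs) ++ ys)
  rest-perm = subst (λ l → IsPerm n l) (sym (++-assoc us vs ys))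
                (drop-mid us [] (subst (_↭ N ∷ interval 0 n) (++-assoc us (N ∷ vs) ys) p))
  rest-above : ∀ {a b} → a ∈ us ++ vs → b ∈ ys → b < a
  rest-above a∈ b∈ with ∈-++⁻ us a∈
  ... | inj₁ a∈us = above (∈-++⁺ˡ a∈us) b∈
  ... | inj₂ a∈vs = above (∈-++⁺ʳ us (there a∈vs)) b∈
  IH = ↭-split-above n (us ++ vs) ys rest-perm rest-above
  ys-perm = proj₁ IH
  L = length (us ++ vs)
  J = length ys
  L+J≡n : L + J ≡ n
  L+J≡n = trans (sym (length-++ (us ++ vs))) (IsPerm⇒length rest-perm)
  N≡J+1+L : N ≡ J + suc L
  N≡J+1+L = begin
    suc n                 ≡⟨ cong suc (sym L+J≡n) ⟩
    suc (L + J)           ≡⟨ cong suc (ℕₚ.+-comm L J) ⟩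
    suc (J + L)           ≡⟨ sym (ℕₚ.+-suc J L) ⟩
    J + suc L             ∎
    where open ≡-Reasoning
  xs-perm : us ++ N ∷ vs ↭ interval J (length (us ++ N ∷ vs))
  xs-perm = subst (λ k → us ++ N ∷ vs ↭ interval J k) (sym (length-++-sucʳ us N vs))
    (↭-trans (↭-shift N us vs) (subst (λ m → N ∷ (us ++ vs) ↭ m ∷ interval J L) N≡J+1+L
                               (↭-prep N (proj₂ IH))))

-- The pattern 132

data Has32Above (a : ℕ) : List ℕ → Set where
  now   : ∀ {b ws} → a < b → Any (λ c → a < c × c < b) ws → Has32Above a (b ∷ ws)
  later : ∀ {b ws} → Has32Above a ws → Has32Above a (b ∷ ws)

data Contains132 : List ℕ → Set where
  now   : ∀ {a ws} → Has32Above a ws → Contains132 (a ∷ ws)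
  later : ∀ {a ws} → Contains132 ws → Contains132 (a ∷ ws)

Avoids132 : List ℕ → Set
Avoids132 σ = ¬ Contains132 σ

module _ where
  open Equivalence

  between-reflects : ∀ a b ws →
    T (foldr (λ c r → ((a <ᵇ c) ∧ (c <ᵇ b)) ∨ r) false ws) ⇔ Any (λ c → a < c × c < b) ws
  between-reflects a b ws = mk⇔ (to′ ws) (from′ ws)
    where
    to′ : ∀ ws → T (foldr (λ c r → ((a <ᵇ c) ∧ (c <ᵇ b)) ∨ r) false ws) → Any (λ c → a < c × c < b) ws
    to′ (c ∷ ws) t with to T-∨ t
    ... | inj₁ t′ = here (ℕₚ.<ᵇ⇒< a c (proj₁ (to T-∧ t′)) , ℕₚ.<ᵇ⇒< c b (proj₂ (to T-∧ t′)))
    ... | inj₂ t′ = there (to′ ws t′)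
    from′ : ∀ ws → Any (λ c → a < c × c < b) ws → T (foldr (λ c r → ((a <ᵇ c) ∧ (c <ᵇ b)) ∨ r) false ws)
    from′ (c ∷ ws) (here (a<c , c<b)) = from T-∨ (inj₁ (from T-∧ (ℕₚ.<⇒<ᵇ a<c , ℕₚ.<⇒<ᵇ c<b)))
    from′ (c ∷ ws) (there p)          = from T-∨ (inj₂ (from′ ws p))

  has32above-reflects : ∀ a ws → T (has32above a ws) ⇔ Has32Above a ws
  has32above-reflects a ws = mk⇔ (to′ ws) (from′ ws)
    where
    to′ : ∀ ws → T (has32above a ws) → Has32Above a ws
    to′ (b ∷ ws) t with to T-∨ t
    ... | inj₁ t′ = now (ℕₚ.<ᵇ⇒< a b (proj₁ (to T-∧ t′))) (to (between-reflects a b ws) (proj₂ (to T-∧ t′)))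
    ... | inj₂ t′ = later (to′ ws t′)
    from′ : ∀ ws → Has32Above a ws → T (has32above a ws)
    from′ (b ∷ ws) (now a<b p) = from T-∨ (inj₁ (from T-∧ (ℕₚ.<⇒<ᵇ a<b , from (between-reflects a b ws) p)))
    from′ (b ∷ ws) (later p)   = from T-∨ (inj₂ (from′ ws p))

  contains132-reflects : ∀ σ → T (contains132 σ) ⇔ Contains132 σ
  contains132-reflects σ = mk⇔ (to′ σ) (from′ σ)
    where
    to′ : ∀ σ → T (contains132 σ) → Contains132 σ
    to′ (a ∷ ws) t with to T-∨ t
    ... | inj₁ t′ = now (to (has32above-reflects a ws) t′)
    ... | inj₂ t′ = later (to′ ws t′)
    from′ : ∀ σ → Contains132 σ → T (contains132 σ)
    from′ (a ∷ ws) (now p)   = from T-∨ (inj₁ (from (has32above-reflects a ws) p))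
    from′ (a ∷ ws) (later p) = from T-∨ (inj₂ (from′ ws p))

  avoids132-reflects : ∀ σ → T (avoids132 σ) ⇔ Avoids132 σ
  avoids132-reflects σ = mk⇔ (to′ σ) (from′ σ)
    where
    to′ : ∀ σ → T (avoids132 σ) → Avoids132 σ
    to′ σ t c with contains132 σ | from (contains132-reflects σ) c
    ... | false | ()
    ... | true  | _ = t
    from′ : ∀ σ → Avoids132 σ → T (avoids132 σ)
    from′ σ ¬c with contains132 σ | to (contains132-reflects σ)
    ... | true  | f = ⊥-elim (¬c (f tt))
    ... | false | _ = tt

Has32Above⇒Any-above : ∀ {a ws} → Has32Above a ws → Any (a <_) ws
Has32Above⇒Any-above (now a<b _) = here a<b
Has32Above⇒Any-above (later p)   = there (Has32Above⇒Any-above p)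

Has32Above-++ʳ : ∀ {a xs} zs → Has32Above a xs → Has32Above a (xs ++ zs)
Has32Above-++ʳ zs (now a<b p) = now a<b (Anyₚ.++⁺ˡ p)
Has32Above-++ʳ zs (later p)   = later (Has32Above-++ʳ zs p)

Contains132-++ʳ : ∀ {xs} zs → Contains132 xs → Contains132 (xs ++ zs)
Contains132-++ʳ zs (now p)   = now (Has32Above-++ʳ zs p)
Contains132-++ʳ zs (later p) = later (Contains132-++ʳ zs p)

Contains132-++ˡ : ∀ {ys} xs → Contains132 ys → Contains132 (xs ++ ys)
Contains132-++ˡ []       p = p
Contains132-++ˡ (x ∷ xs) p = later (Contains132-++ˡ xs p)

Contains132-across-max : ∀ {N a b xs ys} → a ∈ xs → b ∈ ys → a < b → b < N →
                         Contains132 (xs ++ N ∷ ys)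
Contains132-across-max {N} {a} {b} {x ∷ xs} {ys} (here refl) b∈ a<b b<N = now (go xs)
  where
  go : ∀ zs → Has32Above a (zs ++ N ∷ ys)
  go []       = now (ℕₚ.<-trans a<b b<N) (Any.map (λ { refl → a<b , b<N }) b∈)
  go (z ∷ zs) = later (go zs)
Contains132-across-max {xs = x ∷ xs} (there a∈) b∈ a<b b<N = later (Contains132-across-max a∈ b∈ a<b b<N)

-- An occurrence a⋯b⋯c starting in xs can neither use N nor reach into ys, which lies below a.
Has32Above-before-max : ∀ {N a ys} xs → All (_< N) xs → All (_< a) ys →
                        Has32Above a (xs ++ N ∷ ys) → Has32Above a xs
Has32Above-before-max [] _ ys<a (now _ p) =
  ⊥-elim (All.lookupWith (λ c<a a<c∧c<N → ℕₚ.<-asym c<a (proj₁ a<c∧c<N)) ys<a p)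
Has32Above-before-max [] _ ys<a (later p) =
  ⊥-elim (All.lookupWith ℕₚ.<-asym ys<a (Has32Above⇒Any-above p))
Has32Above-before-max (x ∷ xs) (x<N ∷ _) ys<a (now a<x p) with Anyₚ.++⁻ xs p
... | inj₁ p′ = now a<x p′
... | inj₂ (here (_ , N<x)) = ⊥-elim (ℕₚ.<-asym N<x x<N)
... | inj₂ (there p′) = ⊥-elim (All.lookupWith (λ c<a a<c∧c<x → ℕₚ.<-asym c<a (proj₁ a<c∧c<x)) ys<a p′)
Has32Above-before-max (x ∷ xs) (_ ∷ xs<N) ys<a (later p) = later (Has32Above-before-max xs xs<N ys<a p)

++-max-avoids132 : ∀ {N ys} xs → All (_< N) xs → All (_< N) ys → All (λ a → All (_< a) ys) xs →
                   Avoids132 xs → Avoids132 ys → Avoids132 (xs ++ N ∷ ys)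
++-max-avoids132 [] _ ys<N _ _ av-ys (now p) =
  All.lookupWith ℕₚ.<-asym ys<N (Has32Above⇒Any-above p)
++-max-avoids132 [] _ _ _ _ av-ys (later p) = av-ys p
++-max-avoids132 (a ∷ xs) (a<N ∷ xs<N) _ (ys<a ∷ _) av-xs _ (now p) =
  av-xs (now (Has32Above-before-max xs xs<N ys<a p))
++-max-avoids132 (a ∷ xs) (_ ∷ xs<N) ys<N (_ ∷ ys<xs) av-xs av-ys (later p) =
  ++-max-avoids132 xs xs<N ys<N ys<xs (av-xs ∘ later) av-ys p

<ᵇ-+ : ∀ j a b → ((j + a) <ᵇ (j + b)) ≡ (a <ᵇ b)
<ᵇ-+ zero    a b = refl
<ᵇ-+ (suc j) a b = <ᵇ-+ j a b

between-map-+ : ∀ j a b ws →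
  foldr (λ c r → ((j + a <ᵇ c) ∧ (c <ᵇ j + b)) ∨ r) false (map (j +_) ws)
  ≡ foldr (λ c r → ((a <ᵇ c) ∧ (c <ᵇ b)) ∨ r) false ws
between-map-+ j a b []       = refl
between-map-+ j a b (c ∷ ws) rewrite <ᵇ-+ j a c | <ᵇ-+ j c b | between-map-+ j a b ws = refl

has32above-map-+ : ∀ j a ws → has32above (j + a) (map (j +_) ws) ≡ has32above a ws
has32above-map-+ j a []       = refl
has32above-map-+ j a (b ∷ ws) rewrite <ᵇ-+ j a b | between-map-+ j a b ws | has32above-map-+ j a ws = refl

contains132-map-+ : ∀ j ws → contains132 (map (j +_) ws) ≡ contains132 ws
contains132-map-+ j []       = refl
contains132-map-+ j (a ∷ ws) rewrite has32above-map-+ j a ws | contains132-map-+ j ws = refl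

Avoids132-map-+ : ∀ j ws → Avoids132 (map (j +_) ws) ⇔ Avoids132 ws
Avoids132-map-+ j ws = mk⇔
  (λ av c → av (to (contains132-reflects _) (subst T (sym (contains132-map-+ j ws)) (from (contains132-reflects ws) c))))
  (λ av c → av (to (contains132-reflects ws) (subst T (contains132-map-+ j ws) (from (contains132-reflects _) c))))
  where open Equivalence

-- The box statistic

bit : Bool → ℕ
bit true  = 1
bit false = 0

countTrue : (ℕ → Bool) → List ℕ → ℕ
countTrue f L = length (filter (λ i → T? (f i)) L)

countTrue-∷ : ∀ f i L → countTrue f (i ∷ L) ≡ bit (f i) + countTrue f L
countTrue-∷ f i L with f i
... | true  = refl
... | false = refl

countTrue-cong : ∀ {f g} L → (∀ i → f i ≡ g i) → countTrue f L ≡ countTrue g L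
countTrue-cong {f} {g} []      f≗g = refl
countTrue-cong {f} {g} (i ∷ L) f≗g =
  trans (countTrue-∷ f i L) (trans (cong₂ _+_ (cong bit (f≗g i)) (countTrue-cong L f≗g))
                                   (sym (countTrue-∷ g i L)))

countTrue-map : ∀ f g L → countTrue f (map g L) ≡ countTrue (f ∘ g) L
countTrue-map f g []      = refl
countTrue-map f g (i ∷ L) =
  trans (countTrue-∷ f (g i) (map g L))
        (trans (cong (bit (f (g i)) +_) (countTrue-map f g L)) (sym (countTrue-∷ (f ∘ g) i L)))

leftAdj : Maybe ℕ → ℕ → Bool
leftAdj nothing  x = false
leftAdj (just y) x = adj y x

rightAdj : ℕ → List ℕ → Maybe ℕ → Bool
rightAdj x []      nothing  = false
rightAdj x []      (just y) = adj x y
rightAdj x (y ∷ _) _        = adj x y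

-- Boxed entries of τ inside a longer word in which τ is preceded by p and followed by q
-- (nothing at a word end); box σ is boxCount nothing σ nothing.
boxCount : Maybe ℕ → List ℕ → Maybe ℕ → ℕ
boxCount p []      q = 0
boxCount p (x ∷ τ) q = bit (rightAdj x τ q ∨ leftAdj p x) + boxCount (just x) τ q

headOr : List ℕ → Maybe ℕ → Maybe ℕ
headOr []      q = q
headOr (y ∷ _) q = just y

lastOr : Maybe ℕ → List ℕ → Maybe ℕ
lastOr p []       = p
lastOr p (x ∷ xs) = lastOr (just x) xs

boxedAfter : Maybe ℕ → List ℕ → ℕ → Bool
boxedAfter p τ zero    = ((1 <ᵇ length τ) ∧ adj (τ at 0) (τ at 1)) ∨ leftAdj p (τ at 0)
boxedAfter p τ (suc i) = ((suc (suc i) <ᵇ length τ) ∧ adj (τ at suc i) (τ at suc (suc i)))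
                         ∨ adj (τ at i) (τ at suc i)

boxedAfter-nothing : ∀ σ i → boxed σ i ≡ boxedAfter nothing σ i
boxedAfter-nothing σ zero    = refl
boxedAfter-nothing σ (suc i) = refl

boxedAfter-∷ : ∀ p x τ i → boxedAfter p (x ∷ τ) (suc i) ≡ boxedAfter (just x) τ i
boxedAfter-∷ p x τ zero    = refl
boxedAfter-∷ p x τ (suc i) = refl

boxedAfter-head : ∀ p x τ → boxedAfter p (x ∷ τ) 0 ≡ (rightAdj x τ nothing ∨ leftAdj p x)
boxedAfter-head p x []      = refl
boxedAfter-head p x (y ∷ τ) = refl

countTrue-boxedAfter : ∀ p τ → countTrue (boxedAfter p τ) (upTo (length τ)) ≡ boxCount p τ nothing
countTrue-boxedAfter p []      = refl
countTrue-boxedAfter p (x ∷ τ) = begin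
  countTrue (boxedAfter p (x ∷ τ)) (0 ∷ applyUpTo suc (length τ))
    ≡⟨ countTrue-∷ (boxedAfter p (x ∷ τ)) 0 _ ⟩
  bit (boxedAfter p (x ∷ τ) 0) + countTrue (boxedAfter p (x ∷ τ)) (applyUpTo suc (length τ))
    ≡⟨ cong₂ _+_ (cong bit (boxedAfter-head p x τ))
                 (trans (cong (countTrue _) (sym (map-upTo suc (length τ)))) (countTrue-map _ suc (upTo (length τ)))) ⟩
  bit (rightAdj x τ nothing ∨ leftAdj p x) + countTrue (boxedAfter p (x ∷ τ) ∘ suc) (upTo (length τ))
    ≡⟨ cong (bit (rightAdj x τ nothing ∨ leftAdj p x) +_)
            (trans (countTrue-cong (upTo (length τ)) (boxedAfter-∷ p x τ)) (countTrue-boxedAfter (just x) τ)) ⟩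
  boxCount p (x ∷ τ) nothing ∎
  where open ≡-Reasoning

box≡boxCount : ∀ σ → box σ ≡ boxCount nothing σ nothing
box≡boxCount σ = trans (countTrue-cong (upTo (length σ)) (boxedAfter-nothing σ)) (countTrue-boxedAfter nothing σ)

rightAdj-++ : ∀ x xs ys q → rightAdj x (xs ++ ys) q ≡ rightAdj x xs (headOr ys q)
rightAdj-++ x []      []      nothing  = refl
rightAdj-++ x []      []      (just y) = refl
rightAdj-++ x []      (y ∷ _) q        = refl
rightAdj-++ x (z ∷ _) ys      q        = refl

boxCount-++ : ∀ p xs ys q → boxCount p (xs ++ ys) q ≡ boxCount p xs (headOr ys q) + boxCount (lastOr p xs) ys q
boxCount-++ p []       ys q = refl
boxCount-++ p (x ∷ xs) ys q rewrite rightAdj-++ x xs ys q | boxCount-++ (just x) xs ys q =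
  sym (ℕₚ.+-assoc (bit (rightAdj x xs (headOr ys q) ∨ leftAdj p x)) _ _)

boxCount-nonadj-right : ∀ p τ y → leftAdj (lastOr p τ) y ≡ false → boxCount p τ (just y) ≡ boxCount p τ nothing
boxCount-nonadj-right p []          y _ = refl
boxCount-nonadj-right p (x ∷ [])    y e rewrite e = refl
boxCount-nonadj-right p (x ∷ z ∷ τ) y e rewrite boxCount-nonadj-right (just x) (z ∷ τ) y e = refl

lastOr-∷ʳ : ∀ p xs N → lastOr p (xs ++ [ N ]) ≡ just N
lastOr-∷ʳ p []       N = refl
lastOr-∷ʳ p (x ∷ xs) N = lastOr-∷ʳ (just x) xs N

adj-suc : ∀ n → adj (suc n) n ≡ true
adj-suc zero    = refl
adj-suc (suc n) = adj-suc n

adj-suc′ : ∀ n → adj n (suc n) ≡ true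
adj-suc′ zero    = refl
adj-suc′ (suc n) = adj-suc′ n

adj-+ : ∀ j a b → adj (j + a) (j + b) ≡ adj a b
adj-+ zero    a b = refl
adj-+ (suc j) a b = adj-+ j a b

adj-sym : ∀ a b → adj a b ≡ adj b a
adj-sym a b = cong (_≡ᵇ 1) (ℕₚ.∣-∣-comm a b)

adj-far : ∀ {x y} → suc y < x → adj x y ≡ false
adj-far {suc (suc x)} {zero}  (s≤s (s≤s _))   = refl
adj-far {suc x}       {suc y} (s≤s y+1<x)     = adj-far y+1<x

adj-far′ : ∀ {x y} → suc y < x → adj y x ≡ false
adj-far′ {x} {y} lt = trans (adj-sym y x) (adj-far lt)

mapMaybe-+ : ℕ → Maybe ℕ → Maybe ℕ
mapMaybe-+ j nothing  = nothing
mapMaybe-+ j (just x) = just (j + x)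

leftAdj-+ : ∀ j p x → leftAdj (mapMaybe-+ j p) (j + x) ≡ leftAdj p x
leftAdj-+ j nothing  x = refl
leftAdj-+ j (just y) x = adj-+ j y x

rightAdj-+ : ∀ j x τ q → rightAdj (j + x) (map (j +_) τ) (mapMaybe-+ j q) ≡ rightAdj x τ q
rightAdj-+ j x []      nothing  = refl
rightAdj-+ j x []      (just y) = adj-+ j x y
rightAdj-+ j x (y ∷ τ) q        = adj-+ j x y

boxCount-map-+ : ∀ j p τ q → boxCount (mapMaybe-+ j p) (map (j +_) τ) (mapMaybe-+ j q) ≡ boxCount p τ q
boxCount-map-+ j p []      q = refl
boxCount-map-+ j p (x ∷ τ) q rewrite rightAdj-+ j x τ q | leftAdj-+ j p x | boxCount-map-+ j (just x) τ q = refl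

box-map-+ : ∀ j τ → box (map (j +_) τ) ≡ box τ
box-map-+ j τ rewrite box≡boxCount (map (j +_) τ) | box≡boxCount τ = boxCount-map-+ j nothing τ nothing

box-∷-isolated : ∀ x τ → rightAdj x τ nothing ≡ false → box (x ∷ τ) ≡ box τ
box-∷-isolated x []      _ = refl
box-∷-isolated x (y ∷ τ) e rewrite box≡boxCount (x ∷ y ∷ τ) | box≡boxCount (y ∷ τ) | e = refl

box-∷-∷-isolated : ∀ x y γ → adj x y ≡ true → rightAdj y γ nothing ≡ false →
                   box (x ∷ y ∷ γ) ≡ 2 + box γ
box-∷-∷-isolated x y []      e _ rewrite box≡boxCount (x ∷ y ∷ []) | e = refl
box-∷-∷-isolated x y (z ∷ γ) e f rewrite box≡boxCount (x ∷ y ∷ z ∷ γ) | box≡boxCount (z ∷ γ) | e | f = refl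

box-∷-run : ∀ x y z δ → adj x y ≡ true → adj y z ≡ true → box (x ∷ y ∷ z ∷ δ) ≡ 1 + box (y ∷ z ∷ δ)
box-∷-run x y z δ e f rewrite box≡boxCount (x ∷ y ∷ z ∷ δ) | box≡boxCount (y ∷ z ∷ δ) | e | f = refl

box-∷ʳ-isolated : ∀ α x → leftAdj (lastOr nothing α) x ≡ false → box (α ++ [ x ]) ≡ box α
box-∷ʳ-isolated α x e
  rewrite box≡boxCount (α ++ [ x ]) | box≡boxCount α | boxCount-++ nothing α [ x ] nothing
        | boxCount-nonadj-right nothing α x e | e = ℕₚ.+-identityʳ _

box-∷ʳ-∷ʳ-isolated : ∀ γ y x → adj y x ≡ true → leftAdj (lastOr nothing γ) y ≡ false →
                     box (γ ++ y ∷ x ∷ []) ≡ 2 + box γ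
box-∷ʳ-∷ʳ-isolated γ y x e f
  rewrite box≡boxCount (γ ++ y ∷ x ∷ []) | box≡boxCount γ | boxCount-++ nothing γ (y ∷ x ∷ []) nothing
        | boxCount-nonadj-right nothing γ y f | f | e = ℕₚ.+-comm (boxCount nothing γ nothing) 2

box-∷ʳ-run : ∀ δ z y x → adj z y ≡ true → adj y x ≡ true →
             box (δ ++ z ∷ y ∷ x ∷ []) ≡ 1 + box (δ ++ z ∷ y ∷ [])
box-∷ʳ-run δ z y x e f
  rewrite box≡boxCount (δ ++ z ∷ y ∷ x ∷ []) | box≡boxCount (δ ++ z ∷ y ∷ [])
        | boxCount-++ nothing δ (z ∷ y ∷ x ∷ []) nothing | boxCount-++ nothing δ (z ∷ y ∷ []) nothing | e | f
  = +-2≡suc-+-1 (boxCount nothing δ (just z)) (bit (true ∨ leftAdj (lastOr nothing δ) z))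
  where
  +-2≡suc-+-1 : ∀ a b → a + (b + 2) ≡ suc (a + (b + 1))
  +-2≡suc-+-1 a b rewrite ℕₚ.+-suc b 1 | ℕₚ.+-suc a (b + 1) = refl

box-split-after : ∀ α N β → rightAdj N β nothing ≡ false → box (α ++ N ∷ β) ≡ box (α ++ [ N ]) + box β
box-split-after α N β e
  rewrite sym (++-assoc α [ N ] β) | box≡boxCount ((α ++ [ N ]) ++ β) | box≡boxCount (α ++ [ N ]) | box≡boxCount β
        | boxCount-++ nothing (α ++ [ N ]) β nothing | lastOr-∷ʳ nothing α N
  = cong₂ _+_ (left β e) (right β e)
  where
  left : ∀ β → rightAdj N β nothing ≡ false →
         boxCount nothing (α ++ [ N ]) (headOr β nothing) ≡ boxCount nothing (α ++ [ N ]) nothing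
  left []      _ = refl
  left (b ∷ β) e = boxCount-nonadj-right nothing (α ++ [ N ]) b (trans (cong (λ m → leftAdj m b) (lastOr-∷ʳ nothing α N)) e)
  right : ∀ β → rightAdj N β nothing ≡ false → boxCount (just N) β nothing ≡ boxCount nothing β nothing
  right []      _ = refl
  right (b ∷ β) e rewrite e = refl

-- Coefficient sequences

0P : Poly
0P _ = ℤ.+ 0

≈-setoid : Setoid _ _
≈-setoid = record
  { Carrier = Poly
  ; _≈_ = _≈_
  ; isEquivalence = record
    { refl = λ _ → refl ; sym = λ e k → sym (e k) ; trans = λ e f k → trans (e k) (f k) }
  }

open Setoid ≈-setoid using () renaming (refl to ≈-refl; sym to ≈-sym; trans to ≈-trans)

⊕-cong : ∀ {P P′ Q Q′} → P ≈ P′ → Q ≈ Q′ → P ⊕ Q ≈ P′ ⊕ Q′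
⊕-cong e f k = cong₂ ℤ._+_ (e k) (f k)

⊕-congˡ : ∀ {P P′} Q → P ≈ P′ → P ⊕ Q ≈ P′ ⊕ Q
⊕-congˡ Q e = ⊕-cong e (≈-refl {Q})

⊕-congʳ : ∀ P {Q Q′} → Q ≈ Q′ → P ⊕ Q ≈ P ⊕ Q′
⊕-congʳ P e = ⊕-cong (≈-refl {P}) e

⊖-congˡ : ∀ {P P′} Q → P ≈ P′ → P ⊖ Q ≈ P′ ⊖ Q
⊖-congˡ Q e k = cong (ℤ._- Q k) (e k)

⊕-comm : ∀ P Q → P ⊕ Q ≈ Q ⊕ P
⊕-comm P Q k = ℤₚ.+-comm (P k) (Q k)

⊕-assoc : ∀ P Q R → (P ⊕ Q) ⊕ R ≈ P ⊕ (Q ⊕ R)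
⊕-assoc P Q R k = ℤₚ.+-assoc (P k) (Q k) (R k)

⊕-identityˡ : ∀ P → 0P ⊕ P ≈ P
⊕-identityˡ P k = ℤₚ.+-identityˡ (P k)

⊕-identityʳ : ∀ P → P ⊕ 0P ≈ P
⊕-identityʳ P k = ℤₚ.+-identityʳ (P k)

⊕-⊖-cancelˡ : ∀ P Q → (P ⊕ Q) ⊖ P ≈ Q
⊕-⊖-cancelˡ P Q k = solve 2 (λ a b → (a :+ b) :- a := b) refl (P k) (Q k)
  where open +-*-Solver

⊕-cancelˡ : ∀ {P P′ Q Q′} → P ⊕ Q ≈ P′ ⊕ Q′ → P ≈ P′ → Q ≈ Q′
⊕-cancelˡ {P} {P′} {Q} {Q′} e f k =
  trans (sym (⊕-⊖-cancelˡ P Q k)) (trans (cong₂ ℤ._-_ (e k) (f k)) (⊕-⊖-cancelˡ P′ Q′ k))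

X^-self : ∀ m → X^ m m ≡ ℤ.+ 1
X^-self zero    = refl
X^-self (suc m) = X^-self m

X^-other : ∀ {m k} → m ≢ k → X^ m k ≡ ℤ.+ 0
X^-other {m} {k} m≢k with k ≡ᵇ m in eq
... | false = refl
... | true  = ⊥-elim (m≢k (sym (ℕₚ.≡ᵇ⇒≡ k m (subst T (sym eq) tt))))

-- shift m P is x^m · P.
shift : ℕ → Poly → Poly
shift zero    P         = P
shift (suc m) P zero    = ℤ.+ 0
shift (suc m) P (suc k) = shift m P k

shift-cong : ∀ m {P Q} → P ≈ Q → shift m P ≈ shift m Q
shift-cong zero    e k       = e k
shift-cong (suc m) e zero    = refl
shift-cong (suc m) e (suc k) = shift-cong m e k

shift-⊕ : ∀ m P Q → shift m (P ⊕ Q) ≈ shift m P ⊕ shift m Q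
shift-⊕ zero    P Q k       = refl
shift-⊕ (suc m) P Q zero    = refl
shift-⊕ (suc m) P Q (suc k) = shift-⊕ m P Q k

shift-0P : ∀ m → shift m 0P ≈ 0P
shift-0P zero    k       = refl
shift-0P (suc m) zero    = refl
shift-0P (suc m) (suc k) = shift-0P m k

shift-shift : ∀ a b P → shift a (shift b P) ≈ shift (a + b) P
shift-shift zero    b P k       = refl
shift-shift (suc a) b P zero    = refl
shift-shift (suc a) b P (suc k) = shift-shift a b P k

X^-+ : ∀ m a → X^ (m + a) ≈ shift m (X^ a)
X^-+ zero    a k       = refl
X^-+ (suc m) a zero    = refl
X^-+ (suc m) a (suc k) = X^-+ m a k

Σ-cong : ∀ is {F G} → (∀ i → i ∈ is → F i ≈ G i) → Σ[ is ] F ≈ Σ[ is ] G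
Σ-cong []       e = ≈-refl
Σ-cong (i ∷ is) e = ⊕-cong (e i (here refl)) (Σ-cong is (λ j j∈ → e j (there j∈)))

Σ-∷ʳ : ∀ is j F → Σ[ is ++ [ j ] ] F ≈ Σ[ is ] F ⊕ F j
Σ-∷ʳ []       j F = ≈-trans (⊕-identityʳ (F j)) (≈-sym (⊕-identityˡ (F j)))
Σ-∷ʳ (i ∷ is) j F = ≈-trans (⊕-congʳ (F i) (Σ-∷ʳ is j F)) (≈-sym (⊕-assoc (F i) _ (F j)))

shift-Σ : ∀ m is F → shift m (Σ[ is ] F) ≈ Σ[ is ] (λ i → shift m (F i))
shift-Σ m []       F = shift-0P m
shift-Σ m (i ∷ is) F = ≈-trans (shift-⊕ m (F i) (Σ[ is ] F)) (⊕-congʳ (shift m (F i)) (shift-Σ m is F))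

sumOver : (ℕ → ℤ) → List ℕ → ℤ
sumOver g = foldr (λ j r → g j ℤ.+ r) (ℤ.+ 0)

sumOver-cong : ∀ {g g′} L → (∀ j → g j ≡ g′ j) → sumOver g L ≡ sumOver g′ L
sumOver-cong []      e = refl
sumOver-cong (j ∷ L) e = cong₂ ℤ._+_ (e j) (sumOver-cong L e)

sumOver-+ : ∀ g g′ L → sumOver (λ j → g j ℤ.+ g′ j) L ≡ sumOver g L ℤ.+ sumOver g′ L
sumOver-+ g g′ []      = refl
sumOver-+ g g′ (j ∷ L) rewrite sumOver-+ g g′ L =
  solve 4 (λ a b c d → (a :+ b) :+ (c :+ d) := (a :+ c) :+ (b :+ d)) refl (g j) (g′ j) (sumOver g L) (sumOver g′ L)
  where open +-*-Solver

sumOver-0 : ∀ L → sumOver (λ _ → ℤ.+ 0) L ≡ ℤ.+ 0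
sumOver-0 []      = refl
sumOver-0 (j ∷ L) = trans (ℤₚ.+-identityˡ _) (sumOver-0 L)

sumOver-applyUpTo : ∀ g h n → sumOver g (applyUpTo h n) ≡ sumOver (g ∘ h) (upTo n)
sumOver-applyUpTo g h n = trans (cong (sumOver g) (sym (map-upTo h n))) (foldr-map _ h (ℤ.+ 0) (upTo n))

⊛-congˡ : ∀ {P P′} Q → P ≈ P′ → P ⊛ Q ≈ P′ ⊛ Q
⊛-congˡ Q e k = sumOver-cong (upTo (suc k)) (λ j → cong (ℤ._* Q (k ∸ j)) (e j))

⊛-congʳ : ∀ P {Q Q′} → Q ≈ Q′ → P ⊛ Q ≈ P ⊛ Q′
⊛-congʳ P e k = sumOver-cong (upTo (suc k)) (λ j → cong (P j ℤ.*_) (e (k ∸ j)))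

⊛-distribʳ : ∀ P P′ Q → (P ⊕ P′) ⊛ Q ≈ P ⊛ Q ⊕ P′ ⊛ Q
⊛-distribʳ P P′ Q k =
  trans (sumOver-cong (upTo (suc k)) (λ j → ℤₚ.*-distribʳ-+ (Q (k ∸ j)) (P j) (P′ j)))
        (sumOver-+ (λ j → P j ℤ.* Q (k ∸ j)) (λ j → P′ j ℤ.* Q (k ∸ j)) (upTo (suc k)))

0P-⊛ : ∀ Q → 0P ⊛ Q ≈ 0P
0P-⊛ Q k = sumOver-0 (upTo (suc k))

-- Once its vanishing j = 0 term is dropped, (X^ (suc m) ⊛ P) (suc k) is the sum defining (X^ m ⊛ P) k.
X^-⊛ : ∀ m P → X^ m ⊛ P ≈ shift m P
X^-⊛ zero P k = begin
  ℤ.+ 1 ℤ.* P k ℤ.+ sumOver (λ j → X^ 0 j ℤ.* P (k ∸ j)) (applyUpTo suc k)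
    ≡⟨ cong₂ ℤ._+_ (ℤₚ.*-identityˡ (P k))
                   (trans (sumOver-applyUpTo (λ j → X^ 0 j ℤ.* P (k ∸ j)) suc k) (sumOver-0 (upTo k))) ⟩
  P k ℤ.+ ℤ.+ 0
    ≡⟨ ℤₚ.+-identityʳ (P k) ⟩
  P k ∎
  where open ≡-Reasoning
X^-⊛ (suc m) P zero    = refl
X^-⊛ (suc m) P (suc k) =
  trans (ℤₚ.+-identityˡ _)
        (trans (sumOver-applyUpTo (λ j → X^ (suc m) j ℤ.* P (suc k ∸ j)) suc (suc k)) (X^-⊛ m P k))

-- Generating polynomials of weighted lists

gfBy : ∀ {X : Set} → (X → ℕ) → List X → Poly
gfBy w L k = ℤ.+ length (filter (λ x → w x ≟ k) L)

module _ {X : Set} (w : X → ℕ) where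

  gfBy-∷ : ∀ x L → gfBy w (x ∷ L) ≈ X^ (w x) ⊕ gfBy w L
  gfBy-∷ x L k with w x ≟ k
  ... | yes refl rewrite filter-accept (λ y → w y ≟ w x) {x} {L} refl | X^-self (w x) = refl
  ... | no wx≢k rewrite filter-reject (λ y → w y ≟ k) {x} {L} wx≢k | X^-other wx≢k = sym (ℤₚ.+-identityˡ _)

  gfBy-++ : ∀ L M → gfBy w (L ++ M) ≈ gfBy w L ⊕ gfBy w M
  gfBy-++ L M k rewrite filter-++ (λ x → w x ≟ k) L M = cong ℤ.+_ (length-++ (filter (λ x → w x ≟ k) L))

  gfBy-↭ : ∀ {L M} → L ↭ M → gfBy w L ≈ gfBy w M
  gfBy-↭ p k = cong ℤ.+_ (↭-length (filter-↭ (λ x → w x ≟ k) p))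

  gfBy-partition : ∀ {ℓ} {P : Pred X ℓ} (P? : Decidable P) L →
                   gfBy w L ≈ gfBy w (filter P? L) ⊕ gfBy w (filter (¬? ∘ P?) L)
  gfBy-partition P? []      k = refl
  gfBy-partition P? (x ∷ L) with P? x
  ... | yes _ = begin
    gfBy w (x ∷ L)             ≈⟨ gfBy-∷ x L ⟩
    X^ (w x) ⊕ gfBy w L        ≈⟨ ⊕-congʳ (X^ (w x)) (gfBy-partition P? L) ⟩
    X^ (w x) ⊕ (Yes ⊕ No)      ≈⟨ ≈-sym (⊕-assoc (X^ (w x)) Yes No) ⟩
    (X^ (w x) ⊕ Yes) ⊕ No      ≈⟨ ⊕-congˡ No (≈-sym (gfBy-∷ x _)) ⟩
    gfBy w (x ∷ filter P? L) ⊕ No ∎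
    where open SetoidReasoning ≈-setoid
          Yes = gfBy w (filter P? L)
          No  = gfBy w (filter (¬? ∘ P?) L)
  ... | no _ = begin
    gfBy w (x ∷ L)             ≈⟨ gfBy-∷ x L ⟩
    X^ (w x) ⊕ gfBy w L        ≈⟨ ⊕-congʳ (X^ (w x)) (gfBy-partition P? L) ⟩
    X^ (w x) ⊕ (Yes ⊕ No)      ≈⟨ ≈-sym (⊕-assoc (X^ (w x)) Yes No) ⟩
    (X^ (w x) ⊕ Yes) ⊕ No      ≈⟨ ⊕-congˡ No (⊕-comm (X^ (w x)) Yes) ⟩
    (Yes ⊕ X^ (w x)) ⊕ No      ≈⟨ ⊕-assoc Yes (X^ (w x)) No ⟩
    Yes ⊕ (X^ (w x) ⊕ No)      ≈⟨ ⊕-congʳ Yes (≈-sym (gfBy-∷ x _)) ⟩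
    Yes ⊕ gfBy w (x ∷ filter (¬? ∘ P?) L) ∎
    where open SetoidReasoning ≈-setoid
          Yes = gfBy w (filter P? L)
          No  = gfBy w (filter (¬? ∘ P?) L)

gfBy-cong : ∀ {X : Set} {w v : X → ℕ} L → (∀ x → x ∈ L → w x ≡ v x) → gfBy w L ≈ gfBy v L
gfBy-cong {w = w} {v} []      e = ≈-refl
gfBy-cong {w = w} {v} (x ∷ L) e =
  ≈-trans (gfBy-∷ w x L)
    (≈-trans (⊕-cong (λ k → cong (λ m → X^ m k) (e x (here refl))) (gfBy-cong L (λ y y∈ → e y (there y∈))))
             (≈-sym (gfBy-∷ v x L)))

gfBy-map : ∀ {X Y : Set} (w : Y → ℕ) (h : X → Y) L → gfBy w (map h L) ≈ gfBy (w ∘ h) L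
gfBy-map w h []      = ≈-refl
gfBy-map w h (x ∷ L) =
  ≈-trans (gfBy-∷ w (h x) (map h L))
    (≈-trans (⊕-congʳ (X^ (w (h x))) (gfBy-map w h L)) (≈-sym (gfBy-∷ (w ∘ h) x L)))

gfBy-+ : ∀ {X : Set} (w : X → ℕ) m L → gfBy (λ x → m + w x) L ≈ shift m (gfBy w L)
gfBy-+ w m []      = ≈-sym (shift-0P m)
gfBy-+ w m (x ∷ L) =
  ≈-trans (gfBy-∷ (λ x → m + w x) x L)
    (≈-trans (⊕-cong (X^-+ m (w x)) (gfBy-+ w m L))
      (≈-trans (≈-sym (shift-⊕ m (X^ (w x)) (gfBy w L))) (shift-cong m (≈-sym (gfBy-∷ w x L)))))

gfBy-concatMap : ∀ {X : Set} (w : X → ℕ) (T : ℕ → List X) is →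
                 gfBy w (concatMap T is) ≈ Σ[ is ] (λ i → gfBy w (T i))
gfBy-concatMap w T []       = ≈-refl
gfBy-concatMap w T (i ∷ is) =
  ≈-trans (gfBy-++ w (T i) (concatMap T is)) (⊕-congʳ (gfBy w (T i)) (gfBy-concatMap w T is))

gfBy-pairs : ∀ {X Y Z : Set} (h : X → Y → Z) (w : Z → ℕ) (u : X → ℕ) (v : Y → ℕ) L M →
             (∀ x y → x ∈ L → y ∈ M → w (h x y) ≡ u x + v y) →
             gfBy w (concatMap (λ x → map (h x) M) L) ≈ gfBy u L ⊛ gfBy v M
gfBy-pairs h w u v []      M e = ≈-sym (0P-⊛ (gfBy v M))
gfBy-pairs h w u v (x ∷ L) M e = begin
  gfBy w (map (h x) M ++ concatMap (λ x → map (h x) M) L)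
    ≈⟨ gfBy-++ w (map (h x) M) _ ⟩
  gfBy w (map (h x) M) ⊕ gfBy w (concatMap (λ x → map (h x) M) L)
    ≈⟨ ⊕-cong row (gfBy-pairs h w u v L M (λ x′ y x′∈ → e x′ y (there x′∈))) ⟩
  X^ (u x) ⊛ gfBy v M ⊕ gfBy u L ⊛ gfBy v M
    ≈⟨ ≈-sym (⊛-distribʳ (X^ (u x)) (gfBy u L) (gfBy v M)) ⟩
  (X^ (u x) ⊕ gfBy u L) ⊛ gfBy v M
    ≈⟨ ⊛-congˡ (gfBy v M) (≈-sym (gfBy-∷ u x L)) ⟩
  gfBy u (x ∷ L) ⊛ gfBy v M ∎
  where
  open SetoidReasoning ≈-setoid
  row : gfBy w (map (h x) M) ≈ X^ (u x) ⊛ gfBy v M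
  row = begin
    gfBy w (map (h x) M)         ≈⟨ gfBy-map w (h x) M ⟩
    gfBy (w ∘ h x) M             ≈⟨ gfBy-cong M (λ y → e x y (here refl)) ⟩
    gfBy (λ y → u x + v y) M     ≈⟨ gfBy-+ v (u x) M ⟩
    shift (u x) (gfBy v M)       ≈⟨ ≈-sym (X^-⊛ (u x) (gfBy v M)) ⟩
    X^ (u x) ⊛ gfBy v M          ∎

-- 132-avoiding permutations

module _ where
  open Equivalence

  ∈-S132⁻ : ∀ n {σ} → σ ∈ S132 n → IsPerm n σ × Avoids132 σ
  ∈-S132⁻ n σ∈ with ∈-filter⁻ (λ σ → T? (avoids132 σ)) {xs = perms n} σ∈
  ... | σ∈perms , av = perms-sound n σ∈perms , to (avoids132-reflects _) av

  ∈-S132⁺ : ∀ n {σ} → IsPerm n σ → Avoids132 σ → σ ∈ S132 n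
  ∈-S132⁺ n p av = ∈-filter⁺ (λ σ → T? (avoids132 σ)) (perms-complete n p) (from (avoids132-reflects _) av)

S132-unique : ∀ n → Unique (S132 n)
S132-unique n = Uniqueₚ.filter⁺ (λ σ → T? (avoids132 σ)) (perms-unique n)

S132-length : ∀ n {σ} → σ ∈ S132 n → length σ ≡ n
S132-length n σ∈ = IsPerm⇒length (proj₁ (∈-S132⁻ n σ∈))

S132-entry≤ : ∀ n {σ x} → σ ∈ S132 n → x ∈ σ → x ≤ n
S132-entry≤ n σ∈ = IsPerm⇒≤ (proj₁ (∈-S132⁻ n σ∈))

S132-first-max : ∀ n → filter (λ σ → (σ at 0) ≟ suc n) (S132 (suc n)) ↭ map (suc n ∷_) (S132 n)
S132-first-max n =
  unique-set⇒↭ (Uniqueₚ.filter⁺ (λ σ → (σ at 0) ≟ N) (S132-unique N)) (Uniqueₚ.map⁺ ∷-injectiveʳ (S132-unique n))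
               to from
  where
  N = suc n
  to : ∀ {σ} → σ ∈ filter (λ σ → (σ at 0) ≟ N) (S132 N) → σ ∈ map (N ∷_) (S132 n)
  to {σ} σ∈ with ∈-filter⁻ (λ σ → (σ at 0) ≟ N) {xs = S132 N} σ∈
  to {[]}    σ∈ | _ , ()
  to {x ∷ β} σ∈ | σ∈′ , refl with ∈-S132⁻ N σ∈′
  ... | p , av = ∈-map⁺ (N ∷_) (∈-S132⁺ n (drop-∷ p) (av ∘ later))
  from : ∀ {σ} → σ ∈ map (N ∷_) (S132 n) → σ ∈ filter (λ σ → (σ at 0) ≟ N) (S132 N)
  from σ∈ with ∈-map⁻ (N ∷_) σ∈
  ... | β , β∈ , refl with ∈-S132⁻ n β∈
  ... | p , av = ∈-filter⁺ (λ σ → (σ at 0) ≟ N)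
                   (∈-S132⁺ N (↭-prep N p) (++-max-avoids132 [] [] (IsPerm⇒All< p) [] (λ ()) av)) refl

at-length : ∀ α (x : ℕ) ys → (α ++ x ∷ ys) at length α ≡ x
at-length []      x ys = refl
at-length (a ∷ α) x ys = at-length α x ys

∷ʳ-last : ∀ n σ → length σ ≡ suc n → σ ≡ take n σ ++ [ σ at n ]
∷ʳ-last zero    (x ∷ [])    _ = refl
∷ʳ-last (suc n) (x ∷ y ∷ σ) e = cong (x ∷_) (∷ʳ-last n (y ∷ σ) (ℕₚ.suc-injective e))

S132-last-max : ∀ n → filter (λ σ → (σ at n) ≟ suc n) (S132 (suc n)) ↭ map (_++ [ suc n ]) (S132 n)
S132-last-max n =
  unique-set⇒↭ (Uniqueₚ.filter⁺ (λ σ → (σ at n) ≟ N) (S132-unique N))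
               (Uniqueₚ.map⁺ (λ {α} {α′} → ++-cancelʳ [ N ] α α′) (S132-unique n)) to from
  where
  N = suc n
  to : ∀ {σ} → σ ∈ filter (λ σ → (σ at n) ≟ N) (S132 N) → σ ∈ map (_++ [ N ]) (S132 n)
  to {σ} σ∈ with ∈-filter⁻ (λ σ → (σ at n) ≟ N) {xs = S132 N} σ∈
  ... | σ∈′ , σₙ≡N = subst (_∈ map (_++ [ N ]) (S132 n)) (sym σ≡) (∈-map⁺ (_++ [ N ]) α∈)
    where
    α = take n σ
    σ≡ : σ ≡ α ++ [ N ]
    σ≡ = trans (∷ʳ-last n σ (S132-length N σ∈′)) (cong (λ x → α ++ [ x ]) σₙ≡N)
    α∈ : α ∈ S132 n
    α∈ with ∈-S132⁻ N (subst (_∈ S132 N) σ≡ σ∈′)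
    ... | p , av = ∈-S132⁺ n (subst (λ l → IsPerm n l) (++-identityʳ α) (drop-mid α [] p))
                             (av ∘ Contains132-++ʳ [ N ])
  from : ∀ {σ} → σ ∈ map (_++ [ N ]) (S132 n) → σ ∈ filter (λ σ → (σ at n) ≟ N) (S132 N)
  from σ∈ with ∈-map⁻ (_++ [ N ]) σ∈
  ... | α , α∈ , refl with ∈-S132⁻ n α∈
  ... | p , av = ∈-filter⁺ (λ σ → (σ at n) ≟ N)
    (∈-S132⁺ N (↭-trans (↭-shift N α []) (↭-prep N (subst (_↭ interval 0 n) (sym (++-identityʳ α)) p)))
               (++-max-avoids132 α (IsPerm⇒All< p) [] (All.tabulate (λ _ → [])) av (λ ())))
    (subst (λ k → ((α ++ [ N ]) at k) ≡ N) (S132-length n α∈) (at-length α N []))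

glue : ℕ → ℕ → List ℕ → List ℕ → List ℕ
glue N j α β = map (j +_) α ++ N ∷ β

-- The words of S132 N with N in position i (counted from 1).
maxAt : ℕ → ℕ → List (List ℕ)
maxAt N i = concatMap (λ α → map (glue N (N ∸ i) α) (S132 (N ∸ i))) (S132 (i ∸ 1))

positions : ℕ → List ℕ
positions N = 1 ∷ range 2 N

∈-positions⁻ : ∀ n {i} → i ∈ positions (suc n) → ∃ λ k → i ≡ suc k × k ≤ n
∈-positions⁻ n (here refl) = 0 , refl , z≤n
∈-positions⁻ n (there i∈) with ∈-map⁻ (2 +_) i∈
... | u , u∈ , refl = suc u , refl , ∈-upTo⁻ u∈

∈-positions⁺ : ∀ n k → k ≤ n → suc k ∈ positions (suc n)
∈-positions⁺ n zero    _   = here refl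
∈-positions⁺ n (suc u) u<n = there (∈-map⁺ (2 +_) (∈-upTo⁺ u<n))

positions-unique : ∀ n → Unique (positions (suc n))
positions-unique n =
  All.tabulate (λ i∈ eq → let (_ , _ , eq′) = ∈-map⁻ (2 +_) i∈ in 1≢2+ (trans eq eq′))
  ∷ Uniqueₚ.map⁺ (ℕₚ.suc-injective ∘ ℕₚ.suc-injective) (Uniqueₚ.upTo⁺ n)
  where
  1≢2+ : ∀ {u} → 1 ≢ 2 + u
  1≢2+ ()

indexOf : ℕ → List ℕ → ℕ
indexOf N []       = 0
indexOf N (x ∷ xs) with x ≟ N
... | yes _ = 0
... | no  _ = suc (indexOf N xs)

indexOf-++ : ∀ N xs ys → All (_< N) xs → indexOf N (xs ++ N ∷ ys) ≡ length xs
indexOf-++ N []       ys _ with N ≟ N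
... | yes _   = refl
... | no  N≢N = ⊥-elim (N≢N refl)
indexOf-++ N (x ∷ xs) ys (x<N ∷ xs<N) with x ≟ N
... | yes refl = ⊥-elim (ℕₚ.<-irrefl refl x<N)
... | no  _    = cong suc (indexOf-++ N xs ys xs<N)

take-length-++ : ∀ (xs ys : List ℕ) → take (length xs) (xs ++ ys) ≡ xs
take-length-++ []       ys = refl
take-length-++ (x ∷ xs) ys = cong (x ∷_) (take-length-++ xs ys)

map-∸-map-+ : ∀ j (α : List ℕ) → map (_∸ j) (map (j +_) α) ≡ α
map-∸-map-+ j α = trans (sym (map-∘ α)) (trans (map-cong (ℕₚ.m+n∸m≡n j) α) (map-id α))

map-+-map-∸ : ∀ j (xs : List ℕ) → All (j <_) xs → map (j +_) (map (_∸ j) xs) ≡ xs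
map-+-map-∸ j xs j<xs = trans (sym (map-∘ xs)) (map-id-local (All.map (λ j<x → ℕₚ.m+[n∸m]≡n (ℕₚ.<⇒≤ j<x)) j<xs))

module Decomposition (n : ℕ) where
  N = suc n

  module Block (k : ℕ) (k≤n : k ≤ n) where
    j = n ∸ k

    j+k≡n : j + k ≡ n
    j+k≡n = ℕₚ.m∸n+n≡m k≤n

    raised<N : ∀ {α} → IsPerm k α → All (_< N) (map (j +_) α)
    raised<N p = All.tabulate (λ x∈ → let (a , a∈ , eq) = ∈-map⁻ (j +_) x∈ in
      subst (_< N) (sym eq) (s≤s (subst (j + a ≤_) j+k≡n (ℕₚ.+-monoʳ-≤ j (IsPerm⇒≤ p a∈)))))

    glue-∈ : ∀ {α β} → α ∈ S132 k → β ∈ S132 j → glue N j α β ∈ S132 N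
    glue-∈ {α} {β} α∈ β∈ with ∈-S132⁻ k α∈ | ∈-S132⁻ j β∈
    ... | pα , avα | pβ , avβ = ∈-S132⁺ N perm avoids
      where
      α′ = map (j +_) α
      perm : IsPerm N (α′ ++ N ∷ β)
      perm = ↭-trans (↭-shift N α′ β) (↭-prep N
        (subst (λ m → α′ ++ β ↭ interval 0 m) (trans (ℕₚ.+-comm k j) j+k≡n)
          (subst (α′ ++ β ↭_) (interval-++ j k)
            (++⁺ (subst (α′ ↭_) (map-+-interval j k) (↭-map⁺ (j +_) pα)) pβ))))
      β<α′ : All (λ x → All (_< x) β) α′
      β<α′ = All.tabulate (λ x∈ → let (a , a∈ , eq) = ∈-map⁻ (j +_) x∈ in
        subst (λ x → All (_< x) β) (sym eq)
          (All.tabulate (λ b∈ → ℕₚ.≤-<-trans (IsPerm⇒≤ pβ b∈) (ℕₚ.m<m+n j (IsPerm⇒positive pα a∈)))))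
      avoids : Avoids132 (α′ ++ N ∷ β)
      avoids = ++-max-avoids132 α′ (raised<N pα)
                 (All.tabulate (λ b∈ → s≤s (ℕₚ.≤-trans (IsPerm⇒≤ pβ b∈) (ℕₚ.m∸n≤m n k))))
                 β<α′ (Equivalence.from (Avoids132-map-+ j α) avα) avβ

    indexOf-maxAt : ∀ {σ} → σ ∈ maxAt N (suc k) → suc (indexOf N σ) ≡ suc k
    indexOf-maxAt σ∈ with find (∈-concatMap⁻ (λ α → map (glue N j α) (S132 j)) {S132 k} σ∈)
    ... | α , α∈ , σ∈′ with ∈-map⁻ (glue N j α) σ∈′
    ... | β , _ , refl = cong suc (trans (indexOf-++ N (map (j +_) α) β (raised<N (proj₁ (∈-S132⁻ k α∈))))
                                         (trans (length-map (j +_) α) (S132-length k α∈)))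

    -- α is recovered from the first k entries of glue N j α β.
    maxAt-unique : Unique (maxAt N (suc k))
    maxAt-unique = Unique-concatMap (λ α → map (glue N j α) (S132 j)) (λ σ → map (_∸ j) (take k σ)) (S132-unique k)
      (λ α _ → Unique-map-injectiveOn (glue N j α) (S132-unique j)
                 (λ _ _ eq → ∷-injectiveʳ (++-cancelˡ (map (j +_) α) _ _ eq)))
      recover
      where
      recover : ∀ α σ → α ∈ S132 k → σ ∈ map (glue N j α) (S132 j) → map (_∸ j) (take k σ) ≡ α
      recover α σ α∈ σ∈ with ∈-map⁻ (glue N j α) σ∈
      ... | β , _ , refl = begin
        map (_∸ j) (take k (map (j +_) α ++ N ∷ β))
          ≡⟨ cong (λ m → map (_∸ j) (take m (map (j +_) α ++ N ∷ β)))
                  (sym (trans (length-map (j +_) α) (S132-length k α∈))) ⟩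
        map (_∸ j) (take (length (map (j +_) α)) (map (j +_) α ++ N ∷ β))
          ≡⟨ cong (map (_∸ j)) (take-length-++ (map (j +_) α) (N ∷ β)) ⟩
        map (_∸ j) (map (j +_) α)
          ≡⟨ map-∸-map-+ j α ⟩
        α ∎
        where open ≡-Reasoning

  decomposition-unique : Unique (concatMap (maxAt N) (positions N))
  decomposition-unique = Unique-concatMap (maxAt N) (suc ∘ indexOf N) (positions-unique n)
    (λ i i∈ → unique (∈-positions⁻ n i∈))
    (λ i σ i∈ σ∈ → index (∈-positions⁻ n i∈) σ∈)
    where
    unique : ∀ {i} → (∃ λ k → i ≡ suc k × k ≤ n) → Unique (maxAt N i)
    unique (k , refl , k≤n) = Block.maxAt-unique k k≤n
    index : ∀ {i σ} → (∃ λ k → i ≡ suc k × k ≤ n) → σ ∈ maxAt N i → suc (indexOf N σ) ≡ i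
    index (k , refl , k≤n) = Block.indexOf-maxAt k k≤n

  decomposition⊆S132 : ∀ {σ} → σ ∈ concatMap (maxAt N) (positions N) → σ ∈ S132 N
  decomposition⊆S132 σ∈ with find (∈-concatMap⁻ (maxAt N) {positions N} σ∈)
  ... | i , i∈ , σ∈′ with ∈-positions⁻ n i∈
  ... | k , refl , k≤n with find (∈-concatMap⁻ (λ α → map (glue N (n ∸ k) α) (S132 (n ∸ k))) {S132 k} σ∈′)
  ... | α , α∈ , σ∈″ with ∈-map⁻ (glue N (n ∸ k) α) σ∈″
  ... | β , β∈ , refl = Block.glue-∈ k k≤n α∈ β∈

  -- In σ = xs N ys avoiding 132 every entry of xs exceeds every entry of ys.
  S132⊆decomposition : ∀ {σ} → σ ∈ S132 N → σ ∈ concatMap (maxAt N) (positions N)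
  S132⊆decomposition σ∈ with ∈-S132⁻ N σ∈
  ... | p , av with ∈-∃++ (∈-resp-↭ (↭-sym p) (here refl))
  ... | xs , ys , refl =
    ∈-concatMap⁺ (maxAt N) (lose (∈-positions⁺ n k k≤n) (subst (_∈ maxAt N (suc k)) glue≡ glue∈))
    where
    p′ : IsPerm n (xs ++ ys)
    p′ = drop-mid xs [] p
    ys<xs : ∀ {a b} → a ∈ xs → b ∈ ys → b < a
    ys<xs a∈ b∈ = ℕₚ.≤∧≢⇒< (ℕₚ.≮⇒≥ (λ a<b → av (Contains132-across-max a∈ b∈ a<b (s≤s (IsPerm⇒≤ p′ (∈-++⁺ʳ xs b∈))))))
                           (λ eq → Unique-++⇒≢ (IsPerm⇒Unique p) a∈ (there b∈) (sym eq))
    split = ↭-split-above n xs ys p′ ys<xs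
    k = length xs
    J = length ys
    k+J≡n : k + J ≡ n
    k+J≡n = trans (sym (length-++ xs)) (IsPerm⇒length p′)
    k≤n : k ≤ n
    k≤n = subst (k ≤_) k+J≡n (ℕₚ.m≤m+n k J)
    n∸k≡J : n ∸ k ≡ J
    n∸k≡J = trans (cong (_∸ k) (sym k+J≡n)) (ℕₚ.m+n∸m≡n k J)
    α = map (_∸ J) xs
    raise-α : map (J +_) α ≡ xs
    raise-α = map-+-map-∸ J xs (All.tabulate (λ x∈ → proj₁ (∈-interval⁻ J k (∈-resp-↭ (proj₂ split) x∈))))
    α∈ : α ∈ S132 k
    α∈ = ∈-S132⁺ k (subst (α ↭_) (map-∸-interval J k) (↭-map⁺ (_∸ J) (proj₂ split)))
           (Equivalence.to (Avoids132-map-+ J α) (subst Avoids132 (sym raise-α) (av ∘ Contains132-++ʳ (N ∷ ys))))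
    ys∈ : ys ∈ S132 (n ∸ k)
    ys∈ = subst (λ m → ys ∈ S132 m) (sym n∸k≡J) (∈-S132⁺ J (proj₁ split) (av ∘ Contains132-++ˡ xs ∘ later))
    glue∈ : glue N (n ∸ k) α ys ∈ maxAt N (suc k)
    glue∈ = ∈-concatMap⁺ (λ α → map (glue N (n ∸ k) α) (S132 (n ∸ k))) (lose α∈ (∈-map⁺ (glue N (n ∸ k) α) ys∈))
    glue≡ : glue N (n ∸ k) α ys ≡ xs ++ N ∷ ys
    glue≡ = cong (_++ N ∷ ys) (trans (cong (λ m → map (m +_) α) n∸k≡J) raise-α)

S132-decomposition : ∀ n → S132 (suc n) ↭ concatMap (maxAt (suc n)) (positions (suc n))
S132-decomposition n =
  unique-set⇒↭ (S132-unique (suc n)) decomposition-unique S132⊆decomposition decomposition⊆S132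
  where open Decomposition n

-- The recurrences

notFirstMax : ℕ → List (List ℕ)
notFirstMax m = filter (λ σ → ¬? ((σ at 0) ≟ m)) (S132 m)

notLastMax : ℕ → List (List ℕ)
notLastMax m = filter (λ σ → ¬? ((σ at (m ∸ 1)) ≟ m)) (S132 m)

Bᶜ : ℕ → Poly
Bᶜ m = gf (notFirstMax m)

Eᶜ : ℕ → Poly
Eᶜ m = gf (notLastMax m)

-- Words of S132 (p + 2) beginning with p+2, p+1, resp. ending with p+1, p+2.
B₂ : ℕ → Poly
B₂ p = gfBy (λ γ → box (suc (suc p) ∷ suc p ∷ γ)) (S132 p)

E₂ : ℕ → Poly
E₂ p = gfBy (λ γ → box (γ ++ suc p ∷ suc (suc p) ∷ [])) (S132 p)

gfBy-firstMax : ∀ (w : List ℕ → ℕ) m →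
                gfBy w (filter (λ σ → (σ at 0) ≟ suc m) (S132 (suc m))) ≈ gfBy (w ∘ (suc m ∷_)) (S132 m)
gfBy-firstMax w m = ≈-trans (gfBy-↭ w (S132-first-max m)) (gfBy-map w (suc m ∷_) (S132 m))

gfBy-lastMax : ∀ (w : List ℕ → ℕ) m →
               gfBy w (filter (λ σ → (σ at m) ≟ suc m) (S132 (suc m))) ≈ gfBy (w ∘ (_++ [ suc m ])) (S132 m)
gfBy-lastMax w m = ≈-trans (gfBy-↭ w (S132-last-max m)) (gfBy-map w (_++ [ suc m ]) (S132 m))

gfBy-S132-first : ∀ (w : List ℕ → ℕ) m →
                  gfBy w (S132 (suc m)) ≈ gfBy (w ∘ (suc m ∷_)) (S132 m) ⊕ gfBy w (notFirstMax (suc m))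
gfBy-S132-first w m = ≈-trans (gfBy-partition w (λ σ → (σ at 0) ≟ suc m) (S132 (suc m)))
                              (⊕-congˡ (gfBy w (notFirstMax (suc m))) (gfBy-firstMax w m))

gfBy-S132-last : ∀ (w : List ℕ → ℕ) m →
                 gfBy w (S132 (suc m)) ≈ gfBy (w ∘ (_++ [ suc m ])) (S132 m) ⊕ gfBy w (notLastMax (suc m))
gfBy-S132-last w m = ≈-trans (gfBy-partition w (λ σ → (σ at m) ≟ suc m) (S132 (suc m)))
                             (⊕-congˡ (gfBy w (notLastMax (suc m))) (gfBy-lastMax w m))

notFirstMax-isolated : ∀ m {σ} → σ ∈ notFirstMax m → rightAdj (suc m) σ nothing ≡ false
notFirstMax-isolated m {[]}    _  = refl
notFirstMax-isolated m {y ∷ σ} σ∈ with ∈-filter⁻ (λ σ → ¬? ((σ at 0) ≟ m)) {xs = S132 m} σ∈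
... | σ∈′ , y≢m = adj-far (s≤s (ℕₚ.≤∧≢⇒< (S132-entry≤ m σ∈′ (here refl)) y≢m))

lastOr-at : ∀ p σ → length σ ≡ suc p → lastOr nothing σ ≡ just (σ at p)
lastOr-at p σ e = trans (cong (lastOr nothing) (∷ʳ-last p σ e)) (lastOr-∷ʳ nothing (take p σ) (σ at p))

at-∈ : ∀ p σ → length σ ≡ suc p → σ at p ∈ σ
at-∈ p σ e = subst (σ at p ∈_) (sym (∷ʳ-last p σ e)) (∈-++⁺ʳ (take p σ) (here refl))

notLastMax-isolated : ∀ p {σ} → σ ∈ notLastMax (suc p) → leftAdj (lastOr nothing σ) (suc (suc p)) ≡ false
notLastMax-isolated p {σ} σ∈ with ∈-filter⁻ (λ σ → ¬? ((σ at p) ≟ suc p)) {xs = S132 (suc p)} σ∈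
... | σ∈′ , σₚ≢m rewrite lastOr-at p σ (S132-length (suc p) σ∈′) =
  adj-far′ (s≤s (ℕₚ.≤∧≢⇒< (S132-entry≤ (suc p) σ∈′ (at-∈ p σ (S132-length (suc p) σ∈′))) σₚ≢m))

A≈B⊕Bᶜ : ∀ m → A (suc m) ≈ B (suc m) ⊕ Bᶜ (suc m)
A≈B⊕Bᶜ m = gfBy-partition box (λ σ → (σ at 0) ≟ suc m) (S132 (suc m))

A≈E⊕Eᶜ : ∀ m → A (suc m) ≈ E (suc m) ⊕ Eᶜ (suc m)
A≈E⊕Eᶜ m = gfBy-partition box (λ σ → (σ at m) ≟ suc m) (S132 (suc m))

A⊖B≈Bᶜ : ∀ m → A (suc m) ⊖ B (suc m) ≈ Bᶜ (suc m)
A⊖B≈Bᶜ m = ≈-trans (⊖-congˡ (B (suc m)) (A≈B⊕Bᶜ m)) (⊕-⊖-cancelˡ (B (suc m)) (Bᶜ (suc m)))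

B≈Bᶜ⊕B₂ : ∀ p → B (suc (suc p)) ≈ Bᶜ (suc p) ⊕ B₂ p
B≈Bᶜ⊕B₂ p = begin
  B (suc N)                                       ≈⟨ gfBy-firstMax box N ⟩
  gfBy (box ∘ (suc N ∷_)) (S132 N)                ≈⟨ gfBy-S132-first (box ∘ (suc N ∷_)) p ⟩
  B₂ p ⊕ gfBy (box ∘ (suc N ∷_)) (notFirstMax N)  ≈⟨ ⊕-congʳ (B₂ p) isolated ⟩
  B₂ p ⊕ Bᶜ N                                     ≈⟨ ⊕-comm (B₂ p) (Bᶜ N) ⟩
  Bᶜ N ⊕ B₂ p                                     ∎
  where
  open SetoidReasoning ≈-setoid
  N = suc p
  isolated : gfBy (box ∘ (suc N ∷_)) (notFirstMax N) ≈ Bᶜ N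
  isolated = gfBy-cong (notFirstMax N) (λ σ σ∈ → box-∷-isolated (suc N) σ (notFirstMax-isolated N σ∈))

B₂-suc : ∀ p → B₂ (suc p) ≈ shift 2 (Bᶜ (suc p)) ⊕ shift 1 (B₂ p)
B₂-suc p = begin
  B₂ (suc p)                                                      ≈⟨ gfBy-S132-first w p ⟩
  gfBy (w ∘ (N ∷_)) (S132 p) ⊕ gfBy w (notFirstMax N)             ≈⟨ ⊕-cong run isolated ⟩
  shift 1 (B₂ p) ⊕ shift 2 (Bᶜ N)                                 ≈⟨ ⊕-comm (shift 1 (B₂ p)) (shift 2 (Bᶜ N)) ⟩
  shift 2 (Bᶜ N) ⊕ shift 1 (B₂ p)                                 ∎
  where
  open SetoidReasoning ≈-setoid
  N = suc p
  w : List ℕ → ℕ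
  w γ = box (suc (suc N) ∷ suc N ∷ γ)
  run : gfBy (w ∘ (N ∷_)) (S132 p) ≈ shift 1 (B₂ p)
  run = ≈-trans (gfBy-cong (S132 p) (λ δ _ → box-∷-run (suc (suc N)) (suc N) N δ (adj-suc (suc N)) (adj-suc N)))
                (gfBy-+ (λ δ → box (suc N ∷ N ∷ δ)) 1 (S132 p))
  isolated : gfBy w (notFirstMax N) ≈ shift 2 (Bᶜ N)
  isolated = ≈-trans (gfBy-cong (notFirstMax N)
                       (λ γ γ∈ → box-∷-∷-isolated (suc (suc N)) (suc N) γ (adj-suc (suc N)) (notFirstMax-isolated N γ∈)))
                     (gfBy-+ box 2 (notFirstMax N))

E≈Eᶜ⊕E₂ : ∀ p → E (suc (suc p)) ≈ Eᶜ (suc p) ⊕ E₂ p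
E≈Eᶜ⊕E₂ p = begin
  E (suc N)                                                       ≈⟨ gfBy-lastMax box N ⟩
  gfBy w (S132 N)                                                 ≈⟨ gfBy-S132-last w p ⟩
  gfBy (w ∘ (_++ [ N ])) (S132 p) ⊕ gfBy w (notLastMax N)         ≈⟨ ⊕-cong assoc isolated ⟩
  E₂ p ⊕ Eᶜ N                                                     ≈⟨ ⊕-comm (E₂ p) (Eᶜ N) ⟩
  Eᶜ N ⊕ E₂ p                                                     ∎
  where
  open SetoidReasoning ≈-setoid
  N = suc p
  w : List ℕ → ℕ
  w α = box (α ++ [ suc N ])
  assoc : gfBy (w ∘ (_++ [ N ])) (S132 p) ≈ E₂ p
  assoc = gfBy-cong (S132 p) (λ γ _ → cong box (++-assoc γ [ N ] [ suc N ]))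
  isolated : gfBy w (notLastMax N) ≈ Eᶜ N
  isolated = gfBy-cong (notLastMax N) (λ α α∈ → box-∷ʳ-isolated α (suc N) (notLastMax-isolated p α∈))

E₂-suc : ∀ p → E₂ (suc p) ≈ shift 2 (Eᶜ (suc p)) ⊕ shift 1 (E₂ p)
E₂-suc p = begin
  E₂ (suc p)                                                      ≈⟨ gfBy-S132-last w p ⟩
  gfBy (w ∘ (_++ [ N ])) (S132 p) ⊕ gfBy w (notLastMax N)         ≈⟨ ⊕-cong run isolated ⟩
  shift 1 (E₂ p) ⊕ shift 2 (Eᶜ N)                                 ≈⟨ ⊕-comm (shift 1 (E₂ p)) (shift 2 (Eᶜ N)) ⟩
  shift 2 (Eᶜ N) ⊕ shift 1 (E₂ p)                                 ∎
  where
  open SetoidReasoning ≈-setoid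
  N = suc p
  w : List ℕ → ℕ
  w γ = box (γ ++ suc N ∷ suc (suc N) ∷ [])
  run : gfBy (w ∘ (_++ [ N ])) (S132 p) ≈ shift 1 (E₂ p)
  run = ≈-trans (gfBy-cong (S132 p) (λ δ _ → trans (cong box (++-assoc δ [ N ] (suc N ∷ suc (suc N) ∷ [])))
                                                   (box-∷ʳ-run δ N (suc N) (suc (suc N)) (adj-suc′ N) (adj-suc′ (suc N)))))
                (gfBy-+ (λ δ → box (δ ++ N ∷ suc N ∷ [])) 1 (S132 p))
  isolated : gfBy w (notLastMax N) ≈ shift 2 (Eᶜ N)
  isolated = ≈-trans (gfBy-cong (notLastMax N)
                       (λ γ γ∈ → box-∷ʳ-∷ʳ-isolated γ (suc N) (suc (suc N)) (adj-suc′ (suc N)) (notLastMax-isolated p γ∈)))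
                     (gfBy-+ box 2 (notLastMax N))

B₂-zero : B₂ 0 ≈ X^ 2
B₂-zero = ≈-trans (gfBy-∷ (λ γ → box (2 ∷ 1 ∷ γ)) [] []) (⊕-identityʳ (X^ 2))

E₂-zero : E₂ 0 ≈ X^ 2
E₂-zero = ≈-trans (gfBy-∷ (λ γ → box (γ ++ 1 ∷ 2 ∷ [])) [] []) (⊕-identityʳ (X^ 2))

-- Bᶜ = Eᶜ follows from B = E one size down, which drives the simultaneous induction.
B≈E×B₂≈E₂ : ∀ p → B (suc p) ≈ E (suc p) × B₂ p ≈ E₂ p
B≈E×B₂≈E₂ zero    = (λ _ → refl) , ≈-trans B₂-zero (≈-sym E₂-zero)
B≈E×B₂≈E₂ (suc p) with B≈E×B₂≈E₂ p
... | B≈E , B₂≈E₂ =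
  ≈-trans (B≈Bᶜ⊕B₂ p) (≈-trans (⊕-cong Bᶜ≈Eᶜ B₂≈E₂) (≈-sym (E≈Eᶜ⊕E₂ p))) ,
  ≈-trans (B₂-suc p) (≈-trans (⊕-cong (shift-cong 2 Bᶜ≈Eᶜ) (shift-cong 1 B₂≈E₂)) (≈-sym (E₂-suc p)))
  where
  Bᶜ≈Eᶜ : Bᶜ (suc p) ≈ Eᶜ (suc p)
  Bᶜ≈Eᶜ = ⊕-cancelˡ (≈-trans (≈-sym (A≈B⊕Bᶜ p)) (A≈E⊕Eᶜ p)) B≈E

B≈E : ∀ n → 1 ≤ n → B n ≈ E n
B≈E (suc p) _ = proj₁ (B≈E×B₂≈E₂ p)

Σ-range-∷ʳ : ∀ p F → Σ[ range 2 (2 + p) ] F ≈ Σ[ range 2 (1 + p) ] F ⊕ F (2 + p)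
Σ-range-∷ʳ p F k = trans (cong (λ is → (Σ[ is ] F) k) range-∷ʳ) (Σ-∷ʳ (range 2 (1 + p)) (2 + p) F k)
  where
  range-∷ʳ : range 2 (2 + p) ≡ range 2 (1 + p) ++ [ 2 + p ]
  range-∷ʳ = trans (cong (map (2 +_)) (sym (upTo-∷ʳ p))) (map-++ (2 +_) (upTo p) [ p ])

shift-Σ-range : ∀ p (F : ℕ → Poly) →
                shift 1 (Σ[ range 2 p ] (λ i → shift (2 + p ∸ i) (F i))) ≈ Σ[ range 2 p ] (λ i → shift (3 + p ∸ i) (F i))
shift-Σ-range p F =
  ≈-trans (shift-Σ 1 (range 2 p) (λ i → shift (2 + p ∸ i) (F i)))
          (Σ-cong (range 2 p) {λ i → shift 1 (shift (2 + p ∸ i) (F i))} {λ i → shift (3 + p ∸ i) (F i)} term)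
  where
  term : ∀ i → i ∈ range 2 p → shift 1 (shift (2 + p ∸ i) (F i)) ≈ shift (3 + p ∸ i) (F i)
  term i i∈ k with ∈-map⁻ (2 +_) i∈
  ... | u , u∈ , refl = trans (shift-shift 1 (p ∸ u) (F i) k) (cong (λ e → shift e (F i) k) (sym (ℕₚ.+-∸-assoc 1 u≤p)))
    where
    u≤p : u ≤ p
    u≤p = ℕₚ.≤-pred (ℕₚ.≤-trans (∈-upTo⁻ u∈) (ℕₚ.m∸n≤m (suc p) 2))

B₂-closed : ∀ p → B₂ (suc p) ≈ X^ (3 + p) ⊕ Σ[ range 2 (suc p) ] (λ i → shift (3 + p ∸ i) (Bᶜ i))
B₂-closed zero = begin
  B₂ 1                                ≈⟨ B₂-suc 0 ⟩
  shift 2 (Bᶜ 1) ⊕ shift 1 (B₂ 0)     ≈⟨ ⊕-cong (shift-0P 2) (≈-trans (shift-cong 1 B₂-zero) (≈-sym (X^-+ 1 2))) ⟩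
  0P ⊕ X^ 3                           ≈⟨ ⊕-comm 0P (X^ 3) ⟩
  X^ 3 ⊕ 0P                           ∎
  where open SetoidReasoning ≈-setoid
B₂-closed (suc p) = begin
  B₂ (2 + p)                                          ≈⟨ B₂-suc (suc p) ⟩
  shift 2 (Bᶜ (2 + p)) ⊕ shift 1 (B₂ (suc p))         ≈⟨ ⊕-cong last (≈-trans (shift-cong 1 (B₂-closed p)) raised) ⟩
  t (2 + p) ⊕ (X^ (4 + p) ⊕ Σ[ range 2 (1 + p) ] t)   ≈⟨ ≈-trans (⊕-comm (t (2 + p)) _) (⊕-assoc (X^ (4 + p)) _ _) ⟩
  X^ (4 + p) ⊕ (Σ[ range 2 (1 + p) ] t ⊕ t (2 + p))   ≈⟨ ⊕-congʳ (X^ (4 + p)) (≈-sym (Σ-range-∷ʳ p t)) ⟩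
  X^ (4 + p) ⊕ Σ[ range 2 (2 + p) ] t                 ∎
  where
  open SetoidReasoning ≈-setoid
  t : ℕ → Poly
  t i = shift (4 + p ∸ i) (Bᶜ i)
  last : shift 2 (Bᶜ (2 + p)) ≈ t (2 + p)
  last k = cong (λ e → shift e (Bᶜ (2 + p)) k) (sym (ℕₚ.m+n∸n≡m 2 p))
  raised : shift 1 (X^ (3 + p) ⊕ Σ[ range 2 (1 + p) ] (λ i → shift (3 + p ∸ i) (Bᶜ i))) ≈ X^ (4 + p) ⊕ Σ[ range 2 (1 + p) ] t
  raised = ≈-trans (shift-⊕ 1 (X^ (3 + p)) _) (⊕-cong (≈-sym (X^-+ 1 (3 + p))) (shift-Σ-range (suc p) Bᶜ))

B-recurrence : ∀ n → 4 ≤ n →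
               B n ≈ X^ n ⊕ (A (n ∸ 1) ⊖ B (n ∸ 1)) ⊕ Σ[ range 2 (n ∸ 2) ] (λ i → X^ (n ∸ i) ⊛ (A i ⊖ B i))
B-recurrence (suc (suc (suc (suc p)))) (s≤s (s≤s (s≤s (s≤s _)))) = begin
  B n                                                  ≈⟨ B≈Bᶜ⊕B₂ (2 + p) ⟩
  Bᶜ (3 + p) ⊕ B₂ (2 + p)                               ≈⟨ ⊕-congʳ (Bᶜ (3 + p)) (B₂-closed (suc p)) ⟩
  Bᶜ (3 + p) ⊕ (X^ n ⊕ Σ[ range 2 (2 + p) ] t)          ≈⟨ ≈-sym (⊕-assoc (Bᶜ (3 + p)) (X^ n) _) ⟩
  Bᶜ (3 + p) ⊕ X^ n ⊕ Σ[ range 2 (2 + p) ] t            ≈⟨ ⊕-congˡ (Σ[ range 2 (2 + p) ] t) (⊕-comm (Bᶜ (3 + p)) (X^ n)) ⟩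
  X^ n ⊕ Bᶜ (3 + p) ⊕ Σ[ range 2 (2 + p) ] t            ≈⟨ ⊕-cong (⊕-congʳ (X^ n) (≈-sym (A⊖B≈Bᶜ (2 + p))))
                                                                  (Σ-cong (range 2 (2 + p)) term) ⟩
  X^ n ⊕ (A (3 + p) ⊖ B (3 + p)) ⊕ Σ[ range 2 (2 + p) ] (λ i → X^ (n ∸ i) ⊛ (A i ⊖ B i)) ∎
  where
  open SetoidReasoning ≈-setoid
  n = 4 + p
  t : ℕ → Poly
  t i = shift (n ∸ i) (Bᶜ i)
  term : ∀ i → i ∈ range 2 (2 + p) → t i ≈ X^ (n ∸ i) ⊛ (A i ⊖ B i)
  term i i∈ with ∈-map⁻ (2 +_) i∈
  ... | u , _ , refl = ≈-sym (≈-trans (X^-⊛ (n ∸ i) (A i ⊖ B i)) (shift-cong (n ∸ i) (A⊖B≈Bᶜ (suc u))))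

box-glue : ∀ {N j} k α β → j + suc k ≡ N → rightAdj N β nothing ≡ false →
           box (glue N j α β) ≡ box (α ++ [ suc k ]) + box β
box-glue {N} {j} k α β j+1+k≡N isolated = begin
  box (map (j +_) α ++ N ∷ β)                  ≡⟨ box-split-after (map (j +_) α) N β isolated ⟩
  box (map (j +_) α ++ [ N ]) + box β          ≡⟨ cong (λ σ → box σ + box β) raise ⟩
  box (map (j +_) (α ++ [ suc k ])) + box β    ≡⟨ cong (_+ box β) (box-map-+ j (α ++ [ suc k ])) ⟩
  box (α ++ [ suc k ]) + box β                 ∎
  where
  open ≡-Reasoning
  raise : map (j +_) α ++ [ N ] ≡ map (j +_) (α ++ [ suc k ])
  raise = sym (trans (map-++ (j +_) α [ suc k ]) (cong (λ x → map (j +_) α ++ [ x ]) j+1+k≡N))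

A≈gf : ∀ j → A j ≈ gf (S132 j)
A≈gf zero    zero    = refl
A≈gf zero    (suc k) = refl
A≈gf (suc j) k       = refl

A-recurrence : ∀ n → 2 ≤ n → A n ≈ B n ⊕ Σ[ range 2 n ] (λ i → B i ⊛ A (n ∸ i))
A-recurrence (suc n) _ = begin
  A N                                                     ≈⟨ gfBy-↭ box (S132-decomposition n) ⟩
  gfBy box (concatMap (maxAt N) (positions N))            ≈⟨ gfBy-concatMap box (maxAt N) (positions N) ⟩
  gf (maxAt N 1) ⊕ Σ[ range 2 N ] (gf ∘ maxAt N)          ≈⟨ ⊕-cong maxInFront (Σ-cong (range 2 N) maxBehind) ⟩
  B N ⊕ Σ[ range 2 N ] (λ i → B i ⊛ A (N ∸ i))            ∎
  where
  open SetoidReasoning ≈-setoid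
  N = suc n
  maxInFront : gf (maxAt N 1) ≈ B N
  maxInFront = ≈-trans (gfBy-++ box (map (N ∷_) (S132 n)) [])
                 (≈-trans (⊕-identityʳ (gf (map (N ∷_) (S132 n)))) (≈-sym (gfBy-↭ box (S132-first-max n))))
  maxBehind : ∀ i → i ∈ range 2 N → gf (maxAt N i) ≈ B i ⊛ A (N ∸ i)
  maxBehind i i∈ with ∈-map⁻ (2 +_) i∈
  ... | u , u∈ , refl = begin
    gf (maxAt N (suc k))                                   ≈⟨ gfBy-pairs (glue N j) box (λ α → box (α ++ [ suc k ])) box
                                                                          (S132 k) (S132 j) additive ⟩
    gfBy (λ α → box (α ++ [ suc k ])) (S132 k) ⊛ gf (S132 j) ≈⟨ ⊛-congˡ (gf (S132 j)) (≈-sym (gfBy-lastMax box k)) ⟩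
    E (suc k) ⊛ gf (S132 j)                                ≈⟨ ⊛-congˡ (gf (S132 j)) (≈-sym (B≈E (suc k) (s≤s z≤n))) ⟩
    B (suc k) ⊛ gf (S132 j)                                ≈⟨ ⊛-congʳ (B (suc k)) (≈-sym (A≈gf j)) ⟩
    B (suc k) ⊛ A j                                        ∎
    where
    k = suc u
    j = n ∸ k
    k≤n : k ≤ n
    k≤n = ∈-upTo⁻ u∈
    j<n : j < n
    j<n = ℕₚ.∸-monoʳ-< (s≤s z≤n) k≤n
    j+1+k≡N : j + suc k ≡ N
    j+1+k≡N = trans (ℕₚ.+-suc j k) (cong suc (ℕₚ.m∸n+n≡m k≤n))
    additive : ∀ α β → α ∈ S132 k → β ∈ S132 j → box (glue N j α β) ≡ box (α ++ [ suc k ]) + box β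
    additive α []      _ _  = box-glue k α [] j+1+k≡N refl
    additive α (b ∷ β) _ β∈ =
      box-glue k α (b ∷ β) j+1+k≡N (adj-far (s≤s (ℕₚ.≤-<-trans (S132-entry≤ j β∈ (here refl)) j<n)))

lemma1 : ((n : ℕ) → 1 ≤ n → B n ≈ E n)
       × ((n : ℕ) → 4 ≤ n →
            B n ≈ X^ n ⊕ (A (n ∸ 1) ⊖ B (n ∸ 1))
                  ⊕ Σ[ range 2 (n ∸ 2) ] (λ i → X^ (n ∸ i) ⊛ (A i ⊖ B i)))
       × ((n : ℕ) → 2 ≤ n →
            A n ≈ B n ⊕ Σ[ range 2 n ] (λ i → B i ⊛ A (n ∸ i)))
lemma1 = B≈E , B-recurrence , A-recurrence
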